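{- The instance $(G, \omega, S, k)$ is a yes-instance if and only if $(G', \omega', S, k)$ is a yes-instance.
   Context: Graphs have no self-loops but may have multiedges; $m(u,v)$ denotes the number of edges between $u$ and $v$, and $N_G(v)$ the set of neighbors of $v$. Consider the following weighted generalization of Disjoint Even Cycle Transversal: an instance $(G, \omega, S, k)$ consists of a multigraph $G = (V, E)$, a weight function $\omega\colon E \to \{0,1\}$, a set $S \subseteq V$, and an integer $k \ge 0$, where the length (parity) of a cycle is the total weight of its edges modulo two, and $G[V \setminus S]$ has no cycle of even length; it is a yes-instance if there is $X \subseteq V \setminus S$ with $|X| \le k$ such that $G[V \setminus X]$ has no cycle of even length. Assume that $m(u,v) \le 2$ for every pair of vertices, that whenever $m(u,v) = 2$ the two edges between $u$ and $v$ have weights of opposite parity, and that every vertex of $V \setminus S$ has at least two neighbors in $G$, at most one of which lies in $S$. Let $v \in V \setminus S$ have exactly two neighbors $u$ and $w$, and let $p = \max(m(u,v), m(v,w))$. The graph $G'$ is obtained from $G$ by deleting $v$ and adding $p$ parallel edges between $u$ and $w$, with weight function $\omega'$ agreeing with $\omega$ on the remaining edges and defined on the new edges as follows: if $p = 1$, the new edge $e = \{u,w\}$ gets $\omega'(e) = \omega(f) + \omega(f') \pmod 2$, where $f$ is the edge between $u$ and $v$ and $f'$ is the edge between $v$ and $w$; if $p = 2$, the two new edges $e, e'$ get $\omega'(e) = 0$ and $\omega'(e') = 1$. -}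

module Defs where

open import Data.Nat using (ℕ; zero; suc; _+_; _≤_; _⊔_)
open import Data.Nat.DivMod using (_mod_; _%_)
open import Data.Fin using (Fin; zero; suc; toℕ; punchOut; punchIn; _≟_)
open import Data.Fin.Subset using (Subset; _∈_; _∉_; _⊆_; ∁; ∣_∣)
open import Data.Nat.ListAction using (sum)
open import Data.List using (List; []; _∷_; length; lookup; map; allFin; filter; mapMaybe; head; _++_)
open import Data.Maybe using (Maybe; just; nothing)
open import Data.Product using (Σ; ∃; ∃-syntax; _×_; _,_)
open import Data.Sum using (_⊎_)
open import Data.Vec using (tabulate)
import Data.Vec as Vec
open import Function using (_∘_)
open import Function.Definitions using (Injective)
open import Relation.Binary.PropositionalEquality using (_≡_; _≢_)
open import Relation.Nullary using (¬_; Dec; yes; no)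
open import Relation.Nullary.Decidable using (_×-dec_; _⊎-dec_)

-- Edges are
-- identified by their position in the list (Fin (length G)), so parallel
-- edges are distinct edges.

record WEdge (n : ℕ) : Set where
  constructor edge
  field
    end₁ : Fin n
    end₂ : Fin n
    wt   : Fin 2
open WEdge public

WGraph : ℕ → Set
WGraph n = List (WEdge n)

Loopless : ∀ {n} → WGraph n → Set
Loopless {n} G = ∀ (e : Fin (length G)) → end₁ (lookup G e) ≢ end₂ (lookup G e)

Joins : ∀ {n} → Fin n → Fin n → WEdge n → Set
Joins x y ε = (end₁ ε ≡ x × end₂ ε ≡ y) ⊎ (end₁ ε ≡ y × end₂ ε ≡ x)

joins? : ∀ {n} (x y : Fin n) (ε : WEdge n) → Dec (Joins x y ε)
joins? x y ε = ((end₁ ε ≟ x) ×-dec (end₂ ε ≟ y)) ⊎-dec ((end₁ ε ≟ y) ×-dec (end₂ ε ≟ x))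

mult : ∀ {n} → WGraph n → Fin n → Fin n → ℕ
mult G x y = length (filter (joins? x y) G)

Adj : ∀ {n} → WGraph n → Fin n → Fin n → Set
Adj G x y = ∃[ e ] Joins x y (lookup G e)

-- A cycle of length ℓ ≥ 2 consists of pairwise distinct vertices
-- vtx 0, …, vtx (ℓ-1) and pairwise distinct edges edg 0, …, edg (ℓ-1)
-- such that edg i joins vtx i and vtx ((i+1) mod ℓ).
-- (For ℓ = 2 this is a pair of parallel edges.)

next : ∀ {ℓ} → Fin ℓ → Fin ℓ
next {suc ℓ} i = suc (toℕ i) mod (suc ℓ)

record Cycle {n : ℕ} (G : WGraph n) : Set where
  field
    len     : ℕ
    2≤len   : 2 ≤ len
    vtx     : Fin len → Fin n
    edg     : Fin len → Fin (length G)
    vtx-inj : Injective _≡_ _≡_ vtx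
    edg-inj : Injective _≡_ _≡_ edg
    joins   : ∀ i → Joins (vtx i) (vtx (next i)) (lookup G (edg i))
open Cycle public

-- length (parity) of a cycle: total weight of its edges
cycleWeight : ∀ {n} {G : WGraph n} → Cycle G → ℕ
cycleWeight {G = G} C = sum (map (λ i → toℕ (wt (lookup G (edg C i)))) (allFin (len C)))

EvenCycle : ∀ {n} {G : WGraph n} → Cycle G → Set
EvenCycle C = cycleWeight C % 2 ≡ 0

NoEvenCycleAvoiding : ∀ {n} → WGraph n → Subset n → Set
NoEvenCycleAvoiding G X = ¬ (Σ (Cycle G) λ C → EvenCycle C × (∀ i → vtx C i ∉ X))

YesInstance : ∀ {n} → WGraph n → Subset n → ℕ → Set
YesInstance {n} G S k =
  ∃[ X ] (X ⊆ ∁ S × ∣ X ∣ ≤ k × NoEvenCycleAvoiding G X)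

MultAtMost2 : ∀ {n} → WGraph n → Set
MultAtMost2 G = ∀ x y → mult G x y ≤ 2

ParallelOpposite : ∀ {n} → WGraph n → Set
ParallelOpposite G = ∀ x y (e f : Fin (length G)) → e ≢ f →
  Joins x y (lookup G e) → Joins x y (lookup G f) →
  wt (lookup G e) ≢ wt (lookup G f)

DegreeCondition : ∀ {n} → WGraph n → Subset n → Set
DegreeCondition G S = ∀ x → x ∉ S →
  (∃[ y ] ∃[ z ] (y ≢ z × Adj G x y × Adj G x z)) ×
  (∀ y z → Adj G x y → Adj G x z → y ∈ S → z ∈ S → y ≡ z)

ExactlyTwoNeighbours : ∀ {n} → WGraph n → Fin n → Fin n → Fin n → Set
ExactlyTwoNeighbours G v u w =
  u ≢ w × Adj G v u × Adj G v w × (∀ x → Adj G v x → x ≡ u ⊎ x ≡ w)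

-- The reduction: G' is obtained from G (on Fin (suc n)) by deleting v
-- (vertices of G' are Fin n, vertex i of G' being vertex punchIn v i of G)
-- and adding p = max(m(u,v), m(v,w)) parallel edges between u and w.

dropV : ∀ {n} → Fin (suc n) → Fin (suc n) → Maybe (Fin n)
dropV v x with v ≟ x
... | yes _ = nothing
... | no v≢x = just (punchOut v≢x)

dropEdge : ∀ {n} → Fin (suc n) → WEdge (suc n) → Maybe (WEdge n)
dropEdge v (edge a b ω) with dropV v a | dropV v b
... | just a' | just b' = just (edge a' b' ω)
... | _ | _ = nothing

_+₂_ : Fin 2 → Fin 2 → Fin 2
a +₂ b = (toℕ a + toℕ b) mod 2

-- weight of the (first) edge between x and y; used when m(x,y) = 1
edgeWeight : ∀ {n} → WGraph n → Fin n → Fin n → Fin 2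
edgeWeight G x y with head (filter (joins? x y) G)
... | just ε = wt ε
... | nothing = zero

-- the new edges between u' and w' (p = 2: weights 0 and 1;
-- otherwise, i.e. p = 1 under the assumptions: weight ω(f) + ω(f') mod 2)
newEdges : ∀ {n} → WGraph (suc n) → (v u w : Fin (suc n)) → Fin n → Fin n → WGraph n
newEdges G v u w u' w' with mult G u v ⊔ mult G v w
... | 2 = edge u' w' zero ∷ edge u' w' (suc zero) ∷ []
... | _ = edge u' w' (edgeWeight G u v +₂ edgeWeight G v w) ∷ []

reduce : ∀ {n} → WGraph (suc n) → (v u w : Fin (suc n)) → v ≢ u → v ≢ w → WGraph n
reduce G v u w v≢u v≢w =
  mapMaybe (dropEdge v) G ++ newEdges G v u w (punchOut v≢u) (punchOut v≢w)

restrictS : ∀ {n} → Fin (suc n) → Subset (suc n) → Subset n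
restrictS v S = tabulate (λ i → Vec.lookup S (punchIn v i))

module Submission where

-- Cycles of G avoiding v and cycles of G' using only old edges correspond directly.  A cycle of G
-- through v of length two is a pair of parallel edges, hence odd; a longer one runs u – v – w, and
-- replacing these two edges by the new edge of the same parity gives a cycle of G' of the same
-- parity.  Conversely a cycle of G' uses at most one new edge (two new edges form an odd 2-cycle),
-- which expands back into a path u – v – w of matching parity.  Hence a deletion set for G' is one
-- for G, and a deletion set X for G restricts to G', after trading v ∈ X for a neighbour of v
-- outside S, which lies on every cycle through a new edge.

open import Defs

open import Data.Fin using (Fin; zero; suc; toℕ; punchIn; punchOut; _≟_)
import Data.Fin.Properties as Fin
open import Data.Fin.Subset using (Subset; _∈_; _∉_; _⊆_; ∁; ⁅_⁆; _∪_; ∣_∣; inside; outside)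
open import Data.Fin.Subset.Properties
  using (∣p∣≤∣x∷p∣; ∣⁅x⁆∣≡1; x∈⁅x⁆; x∈⁅y⁆⇒x≡y; x∈p∪q⁺; x∈p∪q⁻; _∈?_; x∈∁p⇒x∉p; x∉p⇒x∈∁p)
open import Data.List using (List; []; _∷_; length; lookup; map; allFin; mapMaybe; _++_; filter; head)
  renaming (tabulate to tabulateList)
open import Data.List.Properties using (map-tabulate)
open import Data.Maybe using (Maybe; just; nothing)
open import Data.Nat using (ℕ; zero; suc; pred; _+_; _⊔_; _≤_; _<_; z≤n; s≤s; s≤s⁻¹; _<?_; _≤?_; >-nonZero)
  renaming (_≟_ to _≟ℕ_)
open import Data.Nat.DivMod using (_%_; _mod_; m<n⇒m%n≡m; n%n≡0; %-distribˡ-+; m%n%n≡m%n)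
open import Data.Nat.ListAction using (sum)
open import Data.Nat.Properties
  using ( module ≤-Reasoning; anyUpTo?; +-comm; +-assoc; +-identityʳ; +-suc; suc-injective; suc-pred
        ; ≤-refl; ≤-reflexive; ≤-trans; ≤-total; <⇒≤; <⇒≢; n≮n; <-irrefl; m≤n⇒m≤1+n; m≤n⇒m<n∨m≡n
        ; pred-mono-≤; ≤pred⇒≤; m≤n⇒m⊔n≡n; m≥n⇒m⊔n≡m )
open import Data.Product using (Σ; ∃; _×_; _,_; proj₁; proj₂)
open import Data.Sum using (_⊎_; inj₁; inj₂)
import Data.Sum
open import Data.Unit using (⊤; tt)
open import Data.Vec using ([]; _∷_; here; there)
import Data.Vec as Vec
open import Data.Vec.Properties
  using ([]=⇒lookup; lookup⇒[]=; lookup∘tabulate; tabulate∘lookup; insertAt-punchIn; insertAt-lookup)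
open import Function using (_∘_; id; case_of_)
open import Function.Bundles using (_⇔_; mk⇔)
open import Function.Definitions using (Injective)
open import Level using (0ℓ)
open import Relation.Binary.PropositionalEquality
open import Relation.Nullary using (¬_; Dec; yes; no; ¬?; contradiction)
open import Relation.Nullary.Decidable using (_×-dec_)
open import Relation.Unary using (Pred; Decidable)

sumBelow : ℕ → (ℕ → ℕ) → ℕ
sumBelow zero    f = 0
sumBelow (suc n) f = f 0 + sumBelow n (f ∘ suc)

sumBelow-cong : ∀ n {f g : ℕ → ℕ} → (∀ {i} → i < n → f i ≡ g i) → sumBelow n f ≡ sumBelow n g
sumBelow-cong zero    eq = refl
sumBelow-cong (suc n) eq = cong₂ _+_ (eq (s≤s z≤n)) (sumBelow-cong n (eq ∘ s≤s))

sumBelow-suc : ∀ n (f : ℕ → ℕ) → sumBelow (suc n) f ≡ sumBelow n f + f n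
sumBelow-suc zero    f = +-comm (f 0) 0
sumBelow-suc (suc n) f = trans (cong (f 0 +_) (sumBelow-suc n (f ∘ suc))) (sym (+-assoc (f 0) _ _))

sum-allFin : ∀ n (h : Fin n → ℕ) (f : ℕ → ℕ) → (∀ x → h x ≡ f (toℕ x)) →
             sum (map h (allFin n)) ≡ sumBelow n f
sum-allFin n h f h≗f = trans (cong sum (map-tabulate {n = n} id h)) (go n h f h≗f)
  where
  go : ∀ n (h : Fin n → ℕ) (f : ℕ → ℕ) → (∀ x → h x ≡ f (toℕ x)) →
       sum (tabulateList h) ≡ sumBelow n f
  go zero    h f h≗f = refl
  go (suc n) h f h≗f = cong₂ _+_ (h≗f zero) (go n (h ∘ suc) (f ∘ suc) (h≗f ∘ suc))

≢⇒toℕ+toℕ≡1 : {a b : Fin 2} → a ≢ b → toℕ a + toℕ b ≡ 1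
≢⇒toℕ+toℕ≡1 {zero}     {zero}     a≢b = contradiction refl a≢b
≢⇒toℕ+toℕ≡1 {zero}     {suc zero} _   = refl
≢⇒toℕ+toℕ≡1 {suc zero} {zero}     _   = refl
≢⇒toℕ+toℕ≡1 {suc zero} {suc zero} a≢b = contradiction refl a≢b

+₂-comm : (a b : Fin 2) → a +₂ b ≡ b +₂ a
+₂-comm a b = cong (_mod 2) (+-comm (toℕ a) (toℕ b))

≢⇒+₂-covers : {a b : Fin 2} → a ≢ b → ∀ c d → a +₂ c ≡ d ⊎ b +₂ c ≡ d
≢⇒+₂-covers {zero}     {suc zero} _   zero       zero       = inj₁ refl
≢⇒+₂-covers {zero}     {suc zero} _   zero       (suc zero) = inj₂ refl
≢⇒+₂-covers {zero}     {suc zero} _   (suc zero) zero       = inj₂ refl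
≢⇒+₂-covers {zero}     {suc zero} _   (suc zero) (suc zero) = inj₁ refl
≢⇒+₂-covers {suc zero} {zero}     _   zero       zero       = inj₂ refl
≢⇒+₂-covers {suc zero} {zero}     _   zero       (suc zero) = inj₁ refl
≢⇒+₂-covers {suc zero} {zero}     _   (suc zero) zero       = inj₁ refl
≢⇒+₂-covers {suc zero} {zero}     _   (suc zero) (suc zero) = inj₂ refl
≢⇒+₂-covers {zero}     {zero}     a≢b _          _          = contradiction refl a≢b
≢⇒+₂-covers {suc zero} {suc zero} a≢b _          _          = contradiction refl a≢b

+-toℕ+₂ : ∀ x (a b : Fin 2) → (x + toℕ (a +₂ b)) % 2 ≡ (x + toℕ a + toℕ b) % 2
+-toℕ+₂ x a b = begin
  (x + toℕ (a +₂ b)) % 2                ≡⟨ cong (λ t → (x + t) % 2) (Fin.toℕ-fromℕ< _) ⟩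
  (x + y % 2) % 2                       ≡⟨ %-distribˡ-+ x (y % 2) 2 ⟩
  (x % 2 + y % 2 % 2) % 2               ≡⟨ cong (λ t → (x % 2 + t) % 2) (m%n%n≡m%n y 2) ⟩
  (x % 2 + y % 2) % 2                   ≡⟨ %-distribˡ-+ x y 2 ⟨
  (x + y) % 2                           ≡⟨ cong (_% 2) (+-assoc x (toℕ a) (toℕ b)) ⟨
  (x + toℕ a + toℕ b) % 2               ∎
  where
  open ≡-Reasoning
  y = toℕ a + toℕ b

extend : {A : Set} → ℕ → (ℕ → A) → A → ℕ → A
extend k f a i with i <? k
... | yes _ = f i
... | no  _ = a

module _ {A : Set} {k : ℕ} {f : ℕ → A} {a : A} where

  extend-< : ∀ {i} → i < k → extend k f a i ≡ f i
  extend-< {i} i<k with i <? k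
  ... | yes _   = refl
  ... | no  i≮k = contradiction i<k i≮k

  extend-top : extend k f a k ≡ a
  extend-top with k <? k
  ... | yes k<k = contradiction k<k (n≮n k)
  ... | no  _   = refl

  extend-≤ : ∀ {i} → i ≤ k → (i < k × extend k f a i ≡ f i) ⊎ (i ≡ k × extend k f a i ≡ a)
  extend-≤ i≤k with m≤n⇒m<n∨m≡n i≤k
  ... | inj₁ i<k  = inj₁ (i<k , extend-< i<k)
  ... | inj₂ refl = inj₂ (refl , extend-top)

  extend-inj : (∀ {i j} → i < k → j < k → f i ≡ f j → i ≡ j) → (∀ {i} → i < k → f i ≢ a) →
               ∀ {i j} → i ≤ k → j ≤ k → extend k f a i ≡ extend k f a j → i ≡ j
  extend-inj f-inj fresh i≤k j≤k eq with extend-≤ i≤k | extend-≤ j≤k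
  ... | inj₁ (i<k , p) | inj₁ (j<k , q) = f-inj i<k j<k (trans (sym p) (trans eq q))
  ... | inj₁ (i<k , p) | inj₂ (_ , q)   = contradiction (trans (sym p) (trans eq q)) (fresh i<k)
  ... | inj₂ (_ , p)   | inj₁ (j<k , q) = contradiction (trans (sym q) (trans (sym eq) p)) (fresh j<k)
  ... | inj₂ (i≡k , _) | inj₂ (j≡k , _) = trans i≡k (sym j≡k)

sumBelow-extend : {A : Set} (w : A → ℕ) (k : ℕ) (f : ℕ → A) (a : A) →
                  sumBelow (suc k) (w ∘ extend k f a) ≡ sumBelow k (w ∘ f) + w a
sumBelow-extend w k f a = trans (sumBelow-suc k _)
  (cong₂ _+_ (sumBelow-cong k (cong w ∘ extend-< {f = f} {a})) (cong w (extend-top {k = k} {f = f})))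

sucᶜ : ℕ → ℕ → ℕ
sucᶜ k = extend k suc 0

sucᶜ-< : ∀ {k i} → i < k → sucᶜ k i ≡ suc i
sucᶜ-< = extend-< {f = suc} {0}

sucᶜ-top : ∀ k → sucᶜ k k ≡ 0
sucᶜ-top k = extend-top {k = k} {suc} {0}

sucᶜ-≤ : ∀ {k i} → i ≤ k → sucᶜ k i ≤ k
sucᶜ-≤ {k} i≤k with extend-≤ {f = suc} {0} i≤k
... | inj₁ (i<k , eq) = subst (_≤ k) (sym eq) i<k
... | inj₂ (_ , eq)   = subst (_≤ k) (sym eq) z≤n

sucᶜ-inj : ∀ {k i j} → i ≤ k → j ≤ k → sucᶜ k i ≡ sucᶜ k j → i ≡ j
sucᶜ-inj = extend-inj (λ _ _ → suc-injective) (λ _ ())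

suc%≡sucᶜ : ∀ {k i} → i ≤ k → suc i % suc k ≡ sucᶜ k i
suc%≡sucᶜ {k} i≤k with m≤n⇒m<n∨m≡n i≤k
... | inj₁ i<k  = trans (m<n⇒m%n≡m (s≤s i<k)) (sym (sucᶜ-< i<k))
... | inj₂ refl = trans (n%n≡0 (suc k)) (sym (sucᶜ-top k))

toℕ-next : ∀ {k} (x : Fin (suc k)) → toℕ (next x) ≡ sucᶜ k (toℕ x)
toℕ-next x = trans (Fin.toℕ-fromℕ< _) (suc%≡sucᶜ (s≤s⁻¹ (Fin.toℕ<n x)))

toℕ-mod : ∀ {k i} → i < suc k → toℕ (i mod suc k) ≡ i
toℕ-mod i<k = trans (Fin.toℕ-fromℕ< _) (m<n⇒m%n≡m i<k)

next-mod : ∀ {k i} → i ≤ k → next (i mod suc k) ≡ sucᶜ k i mod suc k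
next-mod {k} {i} i≤k = Fin.toℕ-injective (begin
  toℕ (next (i mod suc k))     ≡⟨ toℕ-next (i mod suc k) ⟩
  sucᶜ k (toℕ (i mod suc k))  ≡⟨ cong (sucᶜ k) (toℕ-mod (s≤s i≤k)) ⟩
  sucᶜ k i                     ≡⟨ toℕ-mod (s≤s (sucᶜ-≤ i≤k)) ⟨
  toℕ (sucᶜ k i mod suc k)    ∎)
  where open ≡-Reasoning

module _ {A : Set} where

  leftIndex : (xs ys : List A) → Fin (length xs) → Fin (length (xs ++ ys))
  leftIndex (x ∷ xs) ys zero    = zero
  leftIndex (x ∷ xs) ys (suc i) = suc (leftIndex xs ys i)

  rightIndex : (xs ys : List A) → Fin (length ys) → Fin (length (xs ++ ys))
  rightIndex []       ys k = k
  rightIndex (x ∷ xs) ys k = suc (rightIndex xs ys k)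

  lookup-leftIndex : ∀ xs ys i → lookup (xs ++ ys) (leftIndex xs ys i) ≡ lookup xs i
  lookup-leftIndex (x ∷ xs) ys zero    = refl
  lookup-leftIndex (x ∷ xs) ys (suc i) = lookup-leftIndex xs ys i

  lookup-rightIndex : ∀ xs ys k → lookup (xs ++ ys) (rightIndex xs ys k) ≡ lookup ys k
  lookup-rightIndex []       ys k = refl
  lookup-rightIndex (x ∷ xs) ys k = lookup-rightIndex xs ys k

  leftIndex-injective : ∀ xs ys {i j} → leftIndex xs ys i ≡ leftIndex xs ys j → i ≡ j
  leftIndex-injective (x ∷ xs) ys {zero}  {zero}  _  = refl
  leftIndex-injective (x ∷ xs) ys {suc i} {suc j} eq = cong suc (leftIndex-injective xs ys (Fin.suc-injective eq))

  leftIndex≢rightIndex : ∀ xs ys i k → leftIndex xs ys i ≢ rightIndex xs ys k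
  leftIndex≢rightIndex (x ∷ xs) ys zero    k ()
  leftIndex≢rightIndex (x ∷ xs) ys (suc i) k eq = leftIndex≢rightIndex xs ys i k (Fin.suc-injective eq)

  splitIndex : ∀ xs ys (e : Fin (length (xs ++ ys))) →
               (∃ λ i → leftIndex xs ys i ≡ e) ⊎ (∃ λ k → rightIndex xs ys k ≡ e)
  splitIndex []       ys e       = inj₂ (e , refl)
  splitIndex (x ∷ xs) ys zero    = inj₁ (zero , refl)
  splitIndex (x ∷ xs) ys (suc e) with splitIndex xs ys e
  ... | inj₁ (i , eq) = inj₁ (suc i , cong suc eq)
  ... | inj₂ (k , eq) = inj₂ (k , cong suc eq)

module _ {A B : Set} (f : A → Maybe B) where

  mapMaybe-origin : ∀ xs → Fin (length (mapMaybe f xs)) → Fin (length xs)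
  mapMaybe-origin (x ∷ xs) i with f x
  mapMaybe-origin (x ∷ xs) zero    | just _  = zero
  mapMaybe-origin (x ∷ xs) (suc i) | just _  = suc (mapMaybe-origin xs i)
  mapMaybe-origin (x ∷ xs) i       | nothing = suc (mapMaybe-origin xs i)

  mapMaybe-origin-spec : ∀ xs i → f (lookup xs (mapMaybe-origin xs i)) ≡ just (lookup (mapMaybe f xs) i)
  mapMaybe-origin-spec (x ∷ xs) i with f x in eq
  mapMaybe-origin-spec (x ∷ xs) zero    | just _  = eq
  mapMaybe-origin-spec (x ∷ xs) (suc i) | just _  = mapMaybe-origin-spec xs i
  mapMaybe-origin-spec (x ∷ xs) i       | nothing = mapMaybe-origin-spec xs i

  mapMaybe-origin-injective : ∀ xs {i j} → mapMaybe-origin xs i ≡ mapMaybe-origin xs j → i ≡ j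
  mapMaybe-origin-injective (x ∷ xs) {i} {j} eq with f x
  mapMaybe-origin-injective (x ∷ xs) {zero}  {zero}  eq | just _  = refl
  mapMaybe-origin-injective (x ∷ xs) {suc i} {suc j} eq | just _  =
    cong suc (mapMaybe-origin-injective xs (Fin.suc-injective eq))
  mapMaybe-origin-injective (x ∷ xs) {i}     {j}     eq | nothing =
    mapMaybe-origin-injective xs (Fin.suc-injective eq)

  mapMaybe-origin-surjective : ∀ xs (j : Fin (length xs)) {b} → f (lookup xs j) ≡ just b →
                               ∃ λ i → mapMaybe-origin xs i ≡ j
  mapMaybe-origin-surjective (x ∷ xs) zero    p with f x
  ... | just _ = zero , refl
  mapMaybe-origin-surjective (x ∷ xs) (suc j) p with f x | mapMaybe-origin-surjective xs j p
  ... | just _  | i , eq = suc i , cong suc eq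
  ... | nothing | i , eq = i , cong suc eq

module _ {A : Set} {P : Pred A 0ℓ} (P? : Decidable P) where

  filter-length-pos : ∀ xs {e : Fin (length xs)} → P (lookup xs e) → 1 ≤ length (filter P? xs)
  filter-length-pos (x ∷ xs) {e} pe with P? x
  ... | yes _ = s≤s z≤n
  filter-length-pos (x ∷ xs) {zero}  px | no ¬px = contradiction px ¬px
  filter-length-pos (x ∷ xs) {suc e} pe | no _   = filter-length-pos xs pe

  filter-length-pos⁻ : ∀ xs → 1 ≤ length (filter P? xs) → ∃ λ e → P (lookup xs e)
  filter-length-pos⁻ (x ∷ xs) l with P? x
  ... | yes px = zero , px
  ... | no  _  = let e , pe = filter-length-pos⁻ xs l in suc e , pe

  head-filter-unique : ∀ xs (e : Fin (length xs)) → P (lookup xs e) → length (filter P? xs) ≤ 1 →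
                       head (filter P? xs) ≡ just (lookup xs e)
  head-filter-unique (x ∷ xs) e pe l with P? x
  head-filter-unique (x ∷ xs) zero    px     l       | yes _  = refl
  head-filter-unique (x ∷ xs) (suc e) pe     (s≤s l) | yes _  =
    contradiction (≤-trans (filter-length-pos xs pe) l) λ ()
  head-filter-unique (x ∷ xs) zero    px     l       | no ¬px = contradiction px ¬px
  head-filter-unique (x ∷ xs) (suc e) pe     l       | no _   = head-filter-unique xs e pe l

  filter-length-two : ∀ xs → 2 ≤ length (filter P? xs) →
                      ∃ λ e → ∃ λ f → e ≢ f × P (lookup xs e) × P (lookup xs f)
  filter-length-two (x ∷ xs) l with P? x
  ... | yes px = let f , pf = filter-length-pos⁻ xs (s≤s⁻¹ l) in zero , suc f , (λ ()) , px , pf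
  ... | no  _  = let e , f , e≢f , pe , pf = filter-length-two xs l
                 in suc e , suc f , e≢f ∘ Fin.suc-injective , pe , pf

∣p∪q∣≤∣p∣+∣q∣ : ∀ {n} (p q : Subset n) → ∣ p ∪ q ∣ ≤ ∣ p ∣ + ∣ q ∣
∣p∪q∣≤∣p∣+∣q∣ []            []            = z≤n
∣p∪q∣≤∣p∣+∣q∣ (outside ∷ p) (outside ∷ q) = ∣p∪q∣≤∣p∣+∣q∣ p q
∣p∪q∣≤∣p∣+∣q∣ (outside ∷ p) (inside  ∷ q) =
  subst (suc ∣ p ∪ q ∣ ≤_) (sym (+-suc ∣ p ∣ ∣ q ∣)) (s≤s (∣p∪q∣≤∣p∣+∣q∣ p q))
∣p∪q∣≤∣p∣+∣q∣ (inside  ∷ p) (outside ∷ q) = s≤s (∣p∪q∣≤∣p∣+∣q∣ p q)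
∣p∪q∣≤∣p∣+∣q∣ (inside  ∷ p) (inside  ∷ q) =
  s≤s (subst (∣ p ∪ q ∣ ≤_) (sym (+-suc ∣ p ∣ ∣ q ∣)) (m≤n⇒m≤1+n (∣p∪q∣≤∣p∣+∣q∣ p q)))

module _ {n : ℕ} (v : Fin (suc n)) where

  ∈-restrictS⁻ : ∀ {X i} → i ∈ restrictS v X → punchIn v i ∈ X
  ∈-restrictS⁻ {X} {i} p =
    lookup⇒[]= _ X (trans (sym (lookup∘tabulate (Vec.lookup X ∘ punchIn v) i)) ([]=⇒lookup p))

  ∈-restrictS⁺ : ∀ {X i} → punchIn v i ∈ X → i ∈ restrictS v X
  ∈-restrictS⁺ {X} {i} p =
    lookup⇒[]= i _ (trans (lookup∘tabulate (Vec.lookup X ∘ punchIn v) i) ([]=⇒lookup p))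

  ∈-insertAt⁻ : ∀ {X i} → punchIn v i ∈ Vec.insertAt X v outside → i ∈ X
  ∈-insertAt⁻ {X} {i} p = lookup⇒[]= i X (trans (sym (insertAt-punchIn X v outside i)) ([]=⇒lookup p))

  ∈-insertAt⁺ : ∀ {X i} → i ∈ X → punchIn v i ∈ Vec.insertAt X v outside
  ∈-insertAt⁺ {X} {i} p = lookup⇒[]= _ _ (trans (insertAt-punchIn X v outside i) ([]=⇒lookup p))

  v∉insertAt : ∀ X → v ∉ Vec.insertAt X v outside
  v∉insertAt X p with () ← trans (sym (insertAt-lookup X v outside)) ([]=⇒lookup p)

∣restrictS∣≤ : ∀ {n} (v : Fin (suc n)) (X : Subset (suc n)) → ∣ restrictS v X ∣ ≤ ∣ X ∣
∣restrictS∣≤ zero (x ∷ X) rewrite tabulate∘lookup X = ∣p∣≤∣x∷p∣ x X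
∣restrictS∣≤ {suc n} (suc v) (inside  ∷ X) = s≤s (∣restrictS∣≤ v X)
∣restrictS∣≤ {suc n} (suc v) (outside ∷ X) = ∣restrictS∣≤ v X

∣restrictS∣< : ∀ {n} (v : Fin (suc n)) (X : Subset (suc n)) → v ∈ X → suc ∣ restrictS v X ∣ ≤ ∣ X ∣
∣restrictS∣< zero (x ∷ X) here rewrite tabulate∘lookup X = ≤-refl
∣restrictS∣< {suc n} (suc v) (inside  ∷ X) (there p) = s≤s (∣restrictS∣< v X p)
∣restrictS∣< {suc n} (suc v) (outside ∷ X) (there p) = ∣restrictS∣< v X p

∣insertAt-outside∣ : ∀ {n} (v : Fin (suc n)) (X : Subset n) → ∣ Vec.insertAt X v outside ∣ ≡ ∣ X ∣
∣insertAt-outside∣ zero    X             = refl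
∣insertAt-outside∣ (suc v) (inside  ∷ X) = cong suc (∣insertAt-outside∣ v X)
∣insertAt-outside∣ (suc v) (outside ∷ X) = ∣insertAt-outside∣ v X

SamePair : {A : Set} → A → A → A → A → Set
SamePair a b x y = (x ≡ a × y ≡ b) ⊎ (x ≡ b × y ≡ a)

module _ {A : Set} {a b x y s t : A} where

  SamePair-fst : SamePair a b x y → SamePair a b s t → s ≡ x ⊎ s ≡ y
  SamePair-fst (inj₁ (x≡a , _)) (inj₁ (s≡a , _)) = inj₁ (trans s≡a (sym x≡a))
  SamePair-fst (inj₁ (_ , y≡b)) (inj₂ (s≡b , _)) = inj₂ (trans s≡b (sym y≡b))
  SamePair-fst (inj₂ (_ , y≡a)) (inj₁ (s≡a , _)) = inj₂ (trans s≡a (sym y≡a))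
  SamePair-fst (inj₂ (x≡b , _)) (inj₂ (s≡b , _)) = inj₁ (trans s≡b (sym x≡b))

  SamePair-snd : SamePair a b x y → SamePair a b s t → t ≡ x ⊎ t ≡ y
  SamePair-snd (inj₁ (x≡a , _)) (inj₂ (_ , t≡a)) = inj₁ (trans t≡a (sym x≡a))
  SamePair-snd (inj₁ (_ , y≡b)) (inj₁ (_ , t≡b)) = inj₂ (trans t≡b (sym y≡b))
  SamePair-snd (inj₂ (_ , y≡a)) (inj₂ (_ , t≡a)) = inj₂ (trans t≡a (sym y≡a))
  SamePair-snd (inj₂ (x≡b , _)) (inj₁ (_ , t≡b)) = inj₁ (trans t≡b (sym x≡b))

Joins-sym : ∀ {n} {x y : Fin n} {ε} → Joins x y ε → Joins y x ε
Joins-sym (inj₁ p) = inj₂ p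
Joins-sym (inj₂ p) = inj₁ p

Joins-ends : ∀ {n} {a b x y : Fin n} {ε} → Joins a b ε → Joins x y ε → SamePair a b x y
Joins-ends (inj₁ (p , q)) (inj₁ (r , s)) = inj₁ (trans (sym r) p , trans (sym s) q)
Joins-ends (inj₁ (p , q)) (inj₂ (r , s)) = inj₂ (trans (sym s) q , trans (sym r) p)
Joins-ends (inj₂ (p , q)) (inj₁ (r , s)) = inj₂ (trans (sym r) p , trans (sym s) q)
Joins-ends (inj₂ (p , q)) (inj₂ (r , s)) = inj₁ (trans (sym s) q , trans (sym r) p)

Joins-other-end : ∀ {n} {v x y : Fin n} {ε} → Joins x v ε → Joins v y ε → x ≢ v → x ≡ y
Joins-other-end {ε = ε} xv vy x≢v with Joins-ends {ε = ε} xv vy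
... | inj₁ (v≡x , _) = contradiction (sym v≡x) x≢v
... | inj₂ (_ , y≡x) = sym y≡x

Avoids : ∀ {n} → Fin n → WEdge n → Set
Avoids v ε = v ≢ end₁ ε × v ≢ end₂ ε

Joins⇒Avoids : ∀ {n} {v x y : Fin n} {ε} → Joins x y ε → x ≢ v → y ≢ v → Avoids v ε
Joins⇒Avoids (inj₁ (p , q)) x≢v y≢v = x≢v ∘ trans (sym p) ∘ sym , y≢v ∘ trans (sym q) ∘ sym
Joins⇒Avoids (inj₂ (p , q)) x≢v y≢v = y≢v ∘ trans (sym p) ∘ sym , x≢v ∘ trans (sym q) ∘ sym

avoids? : ∀ {n} (v : Fin n) ε → Dec (Avoids v ε)
avoids? v ε = ¬? (v ≟ end₁ ε) ×-dec ¬? (v ≟ end₂ ε)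

Avoids-Joins⇒≢ : ∀ {n} {v x y : Fin n} {ε} → Avoids v ε → Joins x y ε → x ≢ v × y ≢ v
Avoids-Joins⇒≢ (v≢e₁ , v≢e₂) (inj₁ (p , q)) = v≢e₁ ∘ sym ∘ trans p , v≢e₂ ∘ sym ∘ trans q
Avoids-Joins⇒≢ (v≢e₁ , v≢e₂) (inj₂ (p , q)) = v≢e₂ ∘ sym ∘ trans q , v≢e₁ ∘ sym ∘ trans p

Avoids⇒¬Joins : ∀ {n} {v y : Fin n} {ε} → Avoids v ε → ¬ Joins v y ε
Avoids⇒¬Joins {ε = ε} avoids joins = proj₁ (Avoids-Joins⇒≢ {ε = ε} avoids joins) refl

module _ {n : ℕ} (v : Fin (suc n)) where

  punchIn-inj : ∀ {x y} → punchIn v x ≡ punchIn v y → x ≡ y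
  punchIn-inj = Fin.punchIn-injective v _ _

  dropV-just : ∀ {x x'} → dropV v x ≡ just x' → x ≡ punchIn v x'
  dropV-just {x} eq with v ≟ x
  dropV-just refl | no v≢x = sym (Fin.punchIn-punchOut v≢x)

  dropV-≢ : ∀ {x} → v ≢ x → ∃ λ x' → dropV v x ≡ just x'
  dropV-≢ {x} v≢x with v ≟ x
  ... | yes v≡x = contradiction v≡x v≢x
  ... | no  v≢x = punchOut v≢x , refl

  record Dropped (ε : WEdge (suc n)) (ε' : WEdge n) : Set where
    field
      end₁-eq : end₁ ε ≡ punchIn v (end₁ ε')
      end₂-eq : end₂ ε ≡ punchIn v (end₂ ε')
      wt-eq   : wt ε ≡ wt ε'

  dropEdge-just : ∀ {ε ε'} → dropEdge v ε ≡ just ε' → Dropped ε ε'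
  dropEdge-just {edge a b ω} eq with dropV v a in ea | dropV v b in eb
  dropEdge-just {edge a b ω} refl | just _ | just _ = record
    { end₁-eq = dropV-just ea ; end₂-eq = dropV-just eb ; wt-eq = refl }

  dropEdge-avoids : ∀ {ε} → Avoids v ε → ∃ λ ε' → dropEdge v ε ≡ just ε'
  dropEdge-avoids {edge a b ω} (v≢a , v≢b) with dropV-≢ v≢a | dropV-≢ v≢b
  ... | a' , ea | b' , eb rewrite ea | eb = edge a' b' ω , refl

  module _ {ε : WEdge (suc n)} {ε' : WEdge n} (d : Dropped ε ε') where
    open Dropped d

    Dropped-avoids : Avoids v ε
    Dropped-avoids = (λ eq → Fin.punchInᵢ≢i v _ (sym (trans eq end₁-eq)))
                   , (λ eq → Fin.punchInᵢ≢i v _ (sym (trans eq end₂-eq)))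

    Dropped-joins : ∀ {x' y'} → Joins x' y' ε' → Joins (punchIn v x') (punchIn v y') ε
    Dropped-joins (inj₁ (p , q)) = inj₁ (trans end₁-eq (cong (punchIn v) p) , trans end₂-eq (cong (punchIn v) q))
    Dropped-joins (inj₂ (p , q)) = inj₂ (trans end₁-eq (cong (punchIn v) p) , trans end₂-eq (cong (punchIn v) q))

    Dropped-joins⁻ : ∀ {x' y'} → Joins (punchIn v x') (punchIn v y') ε → Joins x' y' ε'
    Dropped-joins⁻ (inj₁ (p , q)) = inj₁ (punchIn-inj (trans (sym end₁-eq) p) , punchIn-inj (trans (sym end₂-eq) q))
    Dropped-joins⁻ (inj₂ (p , q)) = inj₂ (punchIn-inj (trans (sym end₁-eq) p) , punchIn-inj (trans (sym end₂-eq) q))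

arcWeight : ∀ {m} (G : WGraph m) → Fin (length G) → ℕ
arcWeight G e = toℕ (wt (lookup G e))

-- Paths are indexed by ℕ: only node i for i ≤ top and arc i for i < top are meaningful.
record Path {m : ℕ} (G : WGraph m) : Set where
  field
    top       : ℕ
    node      : ℕ → Fin m
    arc       : ℕ → Fin (length G)
    node-inj  : ∀ {i j} → i ≤ top → j ≤ top → node i ≡ node j → i ≡ j
    arc-inj   : ∀ {i j} → i < top → j < top → arc i ≡ arc j → i ≡ j
    arc-joins : ∀ {i} → i < top → Joins (node i) (node (suc i)) (lookup G (arc i))
open Path public

module _ {m : ℕ} {G : WGraph m} where

  pathWeight : Path G → ℕ
  pathWeight P = sumBelow (top P) (arcWeight G ∘ arc P)

  Visits : Path G → Fin m → Set
  Visits P x = ∃ λ i → i ≤ top P × node P i ≡ x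

  init : Path G → Path G
  init P = record
    { top       = pred (top P)
    ; node      = node P
    ; arc       = arc P
    ; node-inj  = λ i≤ j≤ → node-inj P (≤pred⇒≤ i≤) (≤pred⇒≤ j≤)
    ; arc-inj   = λ i< j< → arc-inj P (<pred⇒< i<) (<pred⇒< j<)
    ; arc-joins = arc-joins P ∘ <pred⇒<
    }
    where
    <pred⇒< : ∀ {i} → i < pred (top P) → i < top P
    <pred⇒< = ≤pred⇒≤

  pathWeight-init : (P : Path G) → 1 ≤ top P →
                    pathWeight P ≡ pathWeight (init P) + arcWeight G (arc P (pred (top P)))
  pathWeight-init P (s≤s {n = n} _) = sumBelow-suc n (arcWeight G ∘ arc P)

  Visits-init : (P : Path G) → ∀ {x} → Visits (init P) x → Visits P x
  Visits-init P (i , i≤ , eq) = i , ≤pred⇒≤ i≤ , eq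

  module _ (P : Path G) (z : Fin m) (a : Fin (length G))
           (z-fresh : ∀ {i} → i ≤ top P → node P i ≢ z)
           (a-fresh : ∀ {i} → i < top P → arc P i ≢ a)
           (a-joins : Joins (node P (top P)) z (lookup G a)) where

    snoc : Path G
    snoc = record
      { top       = suc (top P)
      ; node      = extend (suc (top P)) (node P) z
      ; arc       = extend (top P) (arc P) a
      ; node-inj  = extend-inj (λ i< j< → node-inj P (s≤s⁻¹ i<) (s≤s⁻¹ j<)) (z-fresh ∘ s≤s⁻¹)
      ; arc-inj   = λ i< j< → extend-inj (arc-inj P) a-fresh (s≤s⁻¹ i<) (s≤s⁻¹ j<)
      ; arc-joins = snoc-joins ∘ s≤s⁻¹
      }
      where
      snoc-joins : ∀ {i} → i ≤ top P →
                   Joins (extend (suc (top P)) (node P) z i) (extend (suc (top P)) (node P) z (suc i))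
                         (lookup G (extend (top P) (arc P) a i))
      snoc-joins {i} i≤ with m≤n⇒m<n∨m≡n i≤
      ... | inj₁ i<  rewrite extend-< {f = arc P} {a} i< | extend-< {f = node P} {z} (s≤s (<⇒≤ i<))
                           | extend-< {f = node P} {z} (s≤s i<) = arc-joins P i<
      ... | inj₂ refl rewrite extend-top {k = top P} {arc P} {a}
                            | extend-< {f = node P} {z} (s≤s (≤-refl {top P}))
                            | extend-top {k = suc (top P)} {node P} {z} = a-joins

    pathWeight-snoc : pathWeight snoc ≡ pathWeight P + arcWeight G a
    pathWeight-snoc = sumBelow-extend (arcWeight G) (top P) (arc P) a

    Visits-snoc : ∀ {x} → Visits snoc x → Visits P x ⊎ z ≡ x
    Visits-snoc (i , i≤ , eq) with extend-≤ {f = node P} {z} i≤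
    ... | inj₁ (i< , p) = inj₁ (i , s≤s⁻¹ i< , trans (sym p) eq)
    ... | inj₂ (_ , p)  = inj₂ (trans (sym p) eq)

record Loop {m : ℕ} (G : WGraph m) : Set where
  field
    path          : Path G
    1≤top         : 1 ≤ top path
    closing       : Fin (length G)
    closing-fresh : ∀ {i} → i < top path → arc path i ≢ closing
    closing-joins : Joins (node path (top path)) (node path 0) (lookup G closing)
open Loop public

module _ {m : ℕ} {G : WGraph m} where

  loopWeight : Loop G → ℕ
  loopWeight L = pathWeight (path L) + arcWeight G (closing L)

  -- arcᶜ L i is the arc leaving node i around the loop; the closing arc is arcᶜ L top.
  arcᶜ : Loop G → ℕ → Fin (length G)
  arcᶜ L = extend (top (path L)) (arc (path L)) (closing L)

  module _ (L : Loop G) where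
    private
      P = path L
      K = top P

    arcᶜ-< : ∀ {i} → i < K → arcᶜ L i ≡ arc P i
    arcᶜ-< = extend-< {f = arc P} {closing L}

    arcᶜ-top : arcᶜ L K ≡ closing L
    arcᶜ-top = extend-top {k = K} {arc P} {closing L}

    arcᶜ-inj : ∀ {i j} → i ≤ K → j ≤ K → arcᶜ L i ≡ arcᶜ L j → i ≡ j
    arcᶜ-inj = extend-inj (arc-inj P) (closing-fresh L)

    arcᶜ-joins : ∀ {i} → i ≤ K → Joins (node P i) (node P (sucᶜ K i)) (lookup G (arcᶜ L i))
    arcᶜ-joins i≤K with m≤n⇒m<n∨m≡n i≤K
    ... | inj₁ i<K  rewrite arcᶜ-< i<K | sucᶜ-< {K} i<K = arc-joins P i<K
    ... | inj₂ refl rewrite arcᶜ-top   | sucᶜ-top K     = closing-joins L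

    loopWeight-arcᶜ : loopWeight L ≡ sumBelow (suc K) (arcWeight G ∘ arcᶜ L)
    loopWeight-arcᶜ = sym (sumBelow-extend (arcWeight G) K (arc P) (closing L))

    rotate : Loop G
    rotate = record
      { path = record
        { top       = K
        ; node      = node P ∘ sucᶜ K
        ; arc       = arcᶜ L ∘ suc
        ; node-inj  = λ i≤ j≤ eq → sucᶜ-inj i≤ j≤ (node-inj P (sucᶜ-≤ i≤) (sucᶜ-≤ j≤) eq)
        ; arc-inj   = λ i< j< eq → suc-injective (arcᶜ-inj i< j< eq)
        ; arc-joins = λ {i} i< → subst (λ x → Joins (node P x) (node P (sucᶜ K (suc i)))
                                                            (lookup G (arcᶜ L (suc i))))
                                       (sym (sucᶜ-< i<)) (arcᶜ-joins i<)
        }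
      ; 1≤top         = 1≤top L
      ; closing       = arc P 0
      ; closing-fresh = λ i< eq → contradiction (arcᶜ-inj i< z≤n (trans eq (sym (arcᶜ-< (1≤top L))))) λ ()
      ; closing-joins = subst₂ (λ x y → Joins (node P x) (node P y) (lookup G (arc P 0)))
                               (sym (sucᶜ-top K)) (sym (sucᶜ-< (1≤top L))) (arc-joins P (1≤top L))
      }

    loopWeight-rotate : loopWeight rotate ≡ loopWeight L
    loopWeight-rotate = begin
      sumBelow K (arcWeight G ∘ arcᶜ L ∘ suc) + arcWeight G (arc P 0)
        ≡⟨ +-comm (sumBelow K (arcWeight G ∘ arcᶜ L ∘ suc)) _ ⟩
      arcWeight G (arc P 0) + sumBelow K (arcWeight G ∘ arcᶜ L ∘ suc)
        ≡⟨ cong (λ e → arcWeight G e + sumBelow K (arcWeight G ∘ arcᶜ L ∘ suc))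
            (sym (arcᶜ-< (1≤top L))) ⟩
      sumBelow (suc K) (arcWeight G ∘ arcᶜ L)
        ≡⟨ sym loopWeight-arcᶜ ⟩
      loopWeight L ∎
      where open ≡-Reasoning

    Visits-rotate : ∀ {x} → Visits (path rotate) x → Visits P x
    Visits-rotate (i , i≤ , eq) = sucᶜ K i , sucᶜ-≤ i≤ , eq

  record RotationAt (L : Loop G) (j : ℕ) : Set where
    field
      loop        : Loop G
      last-node   : node (path loop) (top (path loop)) ≡ node (path L) j
      closing-arc : closing loop ≡ arcᶜ L j
      same-weight : loopWeight loop ≡ loopWeight L
      visits      : ∀ {x} → Visits (path loop) x → Visits (path L) x

  rotateTo : (L : Loop G) → ∀ j → j ≤ top (path L) → RotationAt L j
  rotateTo L zero _ = record
    { loop        = rotate L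
    ; last-node   = cong (node (path L)) (sucᶜ-top (top (path L)))
    ; closing-arc = sym (arcᶜ-< L (1≤top L))
    ; same-weight = loopWeight-rotate L
    ; visits      = Visits-rotate L
    }
  rotateTo L (suc j) j<K = record
    { loop        = loop
    ; last-node   = trans last-node (cong (node (path L)) (sucᶜ-< j<K))
    ; closing-arc = trans closing-arc (arcᶜ-< (rotate L) j<K)
    ; same-weight = trans same-weight (loopWeight-rotate L)
    ; visits      = Visits-rotate L ∘ visits
    }
    where open RotationAt (rotateTo (rotate L) j (<⇒≤ j<K))

  twoLoop-odd : (L : Loop G) → top (path L) ≡ 1 →
                wt (lookup G (arc (path L) 0)) ≢ wt (lookup G (closing L)) → loopWeight L % 2 ≡ 1
  twoLoop-odd L top≡1 weights≢ = begin
    loopWeight L % 2  ≡⟨ cong (λ t → (sumBelow t (arcWeight G ∘ arc (path L)) + c) % 2) top≡1 ⟩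
    (a + 0 + c) % 2   ≡⟨ cong (λ t → (t + c) % 2) (+-identityʳ a) ⟩
    (a + c) % 2       ≡⟨ cong (_% 2) (≢⇒toℕ+toℕ≡1 weights≢) ⟩
    1                 ∎
    where
    open ≡-Reasoning
    a = arcWeight G (arc (path L) 0)
    c = arcWeight G (closing L)

  EvenCycleAvoiding : Subset m → Set
  EvenCycleAvoiding X = Σ (Cycle G) λ C → EvenCycle C × (∀ i → vtx C i ∉ X)

  EvenLoopAvoiding : Subset m → Set
  EvenLoopAvoiding X = Σ (Loop G) λ L → loopWeight L % 2 ≡ 0 × (∀ {x} → Visits (path L) x → x ∉ X)

  cycle⇒loop : (C : Cycle G) → Σ (Loop G) λ L →
               loopWeight L ≡ cycleWeight C × (∀ {x} → Visits (path L) x → ∃ λ i → vtx C i ≡ x)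
  cycle⇒loop C = go (len C) (2≤len C) (vtx C) (edg C) (vtx-inj C) (edg-inj C) (joins C)
    where
    go : ∀ ℓ → 2 ≤ ℓ → (vt : Fin ℓ → Fin m) (ed : Fin ℓ → Fin (length G)) →
         Injective _≡_ _≡_ vt → Injective _≡_ _≡_ ed →
         (∀ i → Joins (vt i) (vt (next i)) (lookup G (ed i))) →
         Σ (Loop G) λ L → loopWeight L ≡ sum (map (arcWeight G ∘ ed) (allFin ℓ)) ×
                           (∀ {x} → Visits (path L) x → ∃ λ i → vt i ≡ x)
    go (suc (suc k)) (s≤s (s≤s z≤n)) vt ed vt-inj ed-inj vt-joins =
      L , weight , λ (i , _ , eq) → i mod ℓ , eq
      where
      ℓ = suc (suc k)
      mod-inj : ∀ {i j} → i ≤ suc k → j ≤ suc k → i mod ℓ ≡ j mod ℓ → i ≡ j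
      mod-inj i≤ j≤ eq = trans (sym (toℕ-mod (s≤s i≤))) (trans (cong toℕ eq) (toℕ-mod (s≤s j≤)))
      joins-mod : ∀ {i} → i ≤ suc k →
                          Joins (vt (i mod ℓ)) (vt (sucᶜ (suc k) i mod ℓ)) (lookup G (ed (i mod ℓ)))
      joins-mod {i} i≤ = subst (λ y → Joins (vt (i mod ℓ)) (vt y) (lookup G (ed (i mod ℓ))))
                         (next-mod i≤) (vt-joins (i mod ℓ))
      L : Loop G
      L = record
        { path = record
          { top       = suc k
          ; node      = vt ∘ (_mod ℓ)
          ; arc       = ed ∘ (_mod ℓ)
          ; node-inj  = λ i≤ j≤ → mod-inj i≤ j≤ ∘ vt-inj
          ; arc-inj   = λ i< j< → mod-inj (<⇒≤ i<) (<⇒≤ j<) ∘ ed-inj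
          ; arc-joins = λ {i} i< → subst (λ y → Joins (vt (i mod ℓ)) (vt (y mod ℓ))
                                                            (lookup G (ed (i mod ℓ))))
                                         (sucᶜ-< i<) (joins-mod (<⇒≤ i<))
          }
        ; 1≤top         = s≤s z≤n
        ; closing       = ed (suc k mod ℓ)
        ; closing-fresh = λ i< eq → <-irrefl (mod-inj (<⇒≤ i<) ≤-refl (ed-inj eq)) i<
        ; closing-joins = subst (λ y → Joins (vt (suc k mod ℓ)) (vt (y mod ℓ)) (lookup G (ed (suc k mod ℓ))))
                                (sucᶜ-top (suc k)) (joins-mod ≤-refl)
        }
      weight : loopWeight L ≡ sum (map (arcWeight G ∘ ed) (allFin ℓ))
      weight = sym (trans (sum-allFin ℓ _ (arcWeight G ∘ ed ∘ (_mod ℓ))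
                             (λ x → cong (arcWeight G ∘ ed) (sym (Fin.toℕ-injective (toℕ-mod (Fin.toℕ<n x))))))
                          (sumBelow-suc (suc k) (arcWeight G ∘ ed ∘ (_mod ℓ))))

  loop⇒cycle : (L : Loop G) → Σ (Cycle G) λ C →
               cycleWeight C ≡ loopWeight L × (∀ i → Visits (path L) (vtx C i))
  loop⇒cycle L = C , weight , λ x → toℕ x , bound x , refl
    where
    K = top (path L)
    bound : (x : Fin (suc K)) → toℕ x ≤ K
    bound x = s≤s⁻¹ (Fin.toℕ<n x)
    C : Cycle G
    C = record
      { len     = suc K
      ; 2≤len   = s≤s (1≤top L)
      ; vtx     = node (path L) ∘ toℕ
      ; edg     = arcᶜ L ∘ toℕ
      ; vtx-inj = λ {x} {y} eq → Fin.toℕ-injective (node-inj (path L) (bound x) (bound y) eq)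
      ; edg-inj = λ {x} {y} eq → Fin.toℕ-injective (arcᶜ-inj L (bound x) (bound y) eq)
      ; joins   = λ x → subst (λ y → Joins (node (path L) (toℕ x)) (node (path L) y)
                                              (lookup G (arcᶜ L (toℕ x))))
                              (sym (toℕ-next x)) (arcᶜ-joins L (bound x))
      }
    weight : cycleWeight C ≡ loopWeight L
    weight = trans (sum-allFin (suc K) _ (arcWeight G ∘ arcᶜ L) (λ _ → refl)) (sym (loopWeight-arcᶜ L))

  evenCycle⇒evenLoop : ∀ {X} → EvenCycleAvoiding X → EvenLoopAvoiding X
  evenCycle⇒evenLoop (C , even , avoids) with cycle⇒loop C
  ... | L , weight , visits = L , trans (cong (_% 2) weight) even ,
    λ visit → subst (_∉ _) (proj₂ (visits visit)) (avoids _)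

  evenLoop⇒evenCycle : ∀ {X} → EvenLoopAvoiding X → EvenCycleAvoiding X
  evenLoop⇒evenCycle (L , even , avoids) with loop⇒cycle L
  ... | C , weight , visits = C , trans (cong (_% 2) weight) even , avoids ∘ visits

noEvenCycle-transfer : ∀ {m m'} {G : WGraph m} {H : WGraph m'} {X Y} →
  (EvenLoopAvoiding {G = H} Y → EvenLoopAvoiding {G = G} X) → NoEvenCycleAvoiding G X → NoEvenCycleAvoiding H Y
noEvenCycle-transfer transfer noEven = noEven ∘ evenLoop⇒evenCycle ∘ transfer ∘ evenCycle⇒evenLoop

record Embedding {m m' : ℕ} (G : WGraph m) (H : WGraph m') : Set₁ where
  field
    NodeDom      : Fin m → Set
    ArcDom       : Fin (length G) → Set
    mapNode      : Fin m → Fin m'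
    mapArc       : Fin (length G) → Fin (length H)
    mapNode-inj  : ∀ {x y} → NodeDom x → NodeDom y → mapNode x ≡ mapNode y → x ≡ y
    mapArc-inj   : ∀ {e f} → ArcDom e → ArcDom f → mapArc e ≡ mapArc f → e ≡ f
    mapArc-joins : ∀ {e x y} → ArcDom e → Joins x y (lookup G e) →
                   Joins (mapNode x) (mapNode y) (lookup H (mapArc e))
    mapArc-wt    : ∀ {e} → ArcDom e → wt (lookup H (mapArc e)) ≡ wt (lookup G e)

module _ {m m' : ℕ} {G : WGraph m} {H : WGraph m'} (φ : Embedding G H) where
  open Embedding φ

  module _ (P : Path G) (nodes∈ : ∀ {i} → i ≤ top P → NodeDom (node P i))
           (arcs∈ : ∀ {i} → i < top P → ArcDom (arc P i)) where

    mapPath : Path H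
    mapPath = record
      { top       = top P
      ; node      = mapNode ∘ node P
      ; arc       = mapArc ∘ arc P
      ; node-inj  = λ i≤ j≤ → node-inj P i≤ j≤ ∘ mapNode-inj (nodes∈ i≤) (nodes∈ j≤)
      ; arc-inj   = λ i< j< → arc-inj P i< j< ∘ mapArc-inj (arcs∈ i<) (arcs∈ j<)
      ; arc-joins = λ i< → mapArc-joins (arcs∈ i<) (arc-joins P i<)
      }

    pathWeight-mapPath : pathWeight mapPath ≡ pathWeight P
    pathWeight-mapPath = sumBelow-cong (top P) (cong toℕ ∘ mapArc-wt ∘ arcs∈)

  module _ (L : Loop G) (nodes∈ : ∀ {i} → i ≤ top (path L) → NodeDom (node (path L) i))
           (arcs∈ : ∀ {i} → i < top (path L) → ArcDom (arc (path L) i)) (closing∈ : ArcDom (closing L)) where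

    mapLoop : Loop H
    mapLoop = record
      { path          = mapPath (path L) nodes∈ arcs∈
      ; 1≤top         = 1≤top L
      ; closing       = mapArc (closing L)
      ; closing-fresh = λ i< → closing-fresh L i< ∘ mapArc-inj (arcs∈ i<) closing∈
      ; closing-joins = mapArc-joins closing∈ (closing-joins L)
      }

    loopWeight-mapLoop : loopWeight mapLoop ≡ loopWeight L
    loopWeight-mapLoop = cong₂ _+_ (pathWeight-mapPath (path L) nodes∈ arcs∈) (cong toℕ (mapArc-wt closing∈))

module _ {n : ℕ} (G : WGraph (suc n)) (v u w : Fin (suc n)) (a b : Fin n) where
  private
    New = newEdges G v u w a b

  newEdges-joins : ∀ k → Joins a b (lookup New k)
  newEdges-joins k with mult G u v ⊔ mult G v w
  newEdges-joins zero       | 0                 = inj₁ (refl , refl)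
  newEdges-joins zero       | 1                 = inj₁ (refl , refl)
  newEdges-joins zero       | 2                 = inj₁ (refl , refl)
  newEdges-joins (suc zero) | 2                 = inj₁ (refl , refl)
  newEdges-joins zero       | suc (suc (suc _)) = inj₁ (refl , refl)

  newEdges-opposite : ∀ {k l} → k ≢ l → wt (lookup New k) ≢ wt (lookup New l)
  newEdges-opposite {k} {l} k≢l with mult G u v ⊔ mult G v w
  newEdges-opposite {zero}     {zero}     k≢l | 0                 = contradiction refl k≢l
  newEdges-opposite {zero}     {zero}     k≢l | 1                 = contradiction refl k≢l
  newEdges-opposite {zero}     {zero}     k≢l | 2                 = contradiction refl k≢l
  newEdges-opposite {zero}     {suc zero} k≢l | 2                 = λ ()
  newEdges-opposite {suc zero} {zero}     k≢l | 2                 = λ ()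
  newEdges-opposite {suc zero} {suc zero} k≢l | 2                 = contradiction refl k≢l
  newEdges-opposite {zero}     {zero}     k≢l | suc (suc (suc _)) = contradiction refl k≢l

  someNewEdge : Fin (length New)
  someNewEdge with mult G u v ⊔ mult G v w
  ... | 0                 = zero
  ... | 1                 = zero
  ... | 2                 = zero
  ... | suc (suc (suc _)) = zero

  newEdges-both-weights : mult G u v ⊔ mult G v w ≡ 2 → ∀ c → ∃ λ k → wt (lookup New k) ≡ c
  newEdges-both-weights p≡2 c with mult G u v ⊔ mult G v w
  newEdges-both-weights refl zero       | .2 = zero , refl
  newEdges-both-weights refl (suc zero) | .2 = suc zero , refl

  newEdges-summed-weight : mult G u v ⊔ mult G v w ≢ 2 →
                           ∀ k → wt (lookup New k) ≡ edgeWeight G u v +₂ edgeWeight G v w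
  newEdges-summed-weight p≢2 k with mult G u v ⊔ mult G v w
  newEdges-summed-weight p≢2 zero | 0                 = refl
  newEdges-summed-weight p≢2 zero | 1                 = refl
  newEdges-summed-weight p≢2 k    | 2                 = contradiction refl p≢2
  newEdges-summed-weight p≢2 zero | suc (suc (suc _)) = refl

edgeWeight-unique : ∀ {n} (G : WGraph n) {x y} e → mult G x y ≤ 1 → Joins x y (lookup G e) →
                    edgeWeight G x y ≡ wt (lookup G e)
edgeWeight-unique G {x} {y} e m≤1 joins with head (filter (joins? x y) G)
  | head-filter-unique (joins? x y) G e joins m≤1
... | just _ | refl = refl

module Reduction {n : ℕ} (G : WGraph (suc n)) (v u w : Fin (suc n)) (v≢u : v ≢ u) (v≢w : v ≢ w)
                 (mult≤2 : MultAtMost2 G) (opposite : ParallelOpposite G) (nbrs : ExactlyTwoNeighbours G v u w) where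

  u' w' : Fin n
  u' = punchOut v≢u
  w' = punchOut v≢w

  Old New G' : List (WEdge n)
  Old = mapMaybe (dropEdge v) G
  New = newEdges G v u w u' w'
  G'  = reduce G v u w v≢u v≢w

  oldEdge : Fin (length Old) → Fin (length G')
  oldEdge = leftIndex Old New

  newEdge : Fin (length New) → Fin (length G')
  newEdge = rightIndex Old New

  IsOld IsNew : Fin (length G') → Set
  IsOld e' = ∃ λ j → oldEdge j ≡ e'
  IsNew e' = ∃ λ k → newEdge k ≡ e'

  old-or-new : ∀ e' → IsOld e' ⊎ IsNew e'
  old-or-new = splitIndex Old New

  origin : Fin (length Old) → Fin (length G)
  origin = mapMaybe-origin (dropEdge v) G

  origin-dropped : ∀ j → Dropped v (lookup G (origin j)) (lookup G' (oldEdge j))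
  origin-dropped j = subst (Dropped v (lookup G (origin j))) (sym (lookup-leftIndex Old New j))
                           (dropEdge-just v (mapMaybe-origin-spec (dropEdge v) G j))

  origin-wt : ∀ j → wt (lookup G (origin j)) ≡ wt (lookup G' (oldEdge j))
  origin-wt j = Dropped.wt-eq (origin-dropped j)

  newEdge-joins : ∀ k → Joins u' w' (lookup G' (newEdge k))
  newEdge-joins k = subst (Joins u' w') (sym (lookup-rightIndex Old New k)) (newEdges-joins G v u w u' w' k)

  newEdge-opposite : ∀ {k l} → k ≢ l → wt (lookup G' (newEdge k)) ≢ wt (lookup G' (newEdge l))
  newEdge-opposite {k} {l} k≢l = subst₂ _≢_ (sym (cong wt (lookup-rightIndex Old New k)))
                                            (sym (cong wt (lookup-rightIndex Old New l)))
                                            (newEdges-opposite G v u w u' w' k≢l)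

  punchIn-u' : punchIn v u' ≡ u
  punchIn-u' = Fin.punchIn-punchOut v≢u

  punchIn-w' : punchIn v w' ≡ w
  punchIn-w' = Fin.punchIn-punchOut v≢w

  u≢w : u ≢ w
  u≢w = proj₁ nbrs

  neighbour-of-v : ∀ {x e} → Joins v x (lookup G e) → x ≡ u ⊎ x ≡ w
  neighbour-of-v {x} {e} joins = proj₂ (proj₂ (proj₂ nbrs)) x (e , joins)

  neighbours-of-v : ∀ {x y e f} → Joins x v (lookup G e) → Joins v y (lookup G f) → x ≢ y → SamePair u w x y
  neighbours-of-v {e = e} xv vy x≢y with neighbour-of-v (Joins-sym {ε = lookup G e} xv) | neighbour-of-v vy
  ... | inj₁ x≡u | inj₁ y≡u = contradiction (trans x≡u (sym y≡u)) x≢y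
  ... | inj₁ x≡u | inj₂ y≡w = inj₁ (x≡u , y≡w)
  ... | inj₂ x≡w | inj₁ y≡u = inj₂ (x≡w , y≡u)
  ... | inj₂ x≡w | inj₂ y≡w = contradiction (trans x≡w (sym y≡w)) x≢y

  p : ℕ
  p = mult G u v ⊔ mult G v w

  p≢2⇒simple : p ≢ 2 → mult G u v ≤ 1 × mult G v w ≤ 1
  p≢2⇒simple p≢2 = ≤2∧≢2⇒≤1 (mult≤2 u v)
                   (λ eq → p≢2 (trans (cong (_⊔ mult G v w) eq) (m≥n⇒m⊔n≡m (mult≤2 v w))))
                 , ≤2∧≢2⇒≤1 (mult≤2 v w)
                   (λ eq → p≢2 (trans (cong (mult G u v ⊔_) eq) (m≤n⇒m⊔n≡n (mult≤2 u v))))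
    where
    ≤2∧≢2⇒≤1 : ∀ {x} → x ≤ 2 → x ≢ 2 → x ≤ 1
    ≤2∧≢2⇒≤1 {0}     _             _   = z≤n
    ≤2∧≢2⇒≤1 {1}     _             _   = s≤s z≤n
    ≤2∧≢2⇒≤1 {2}     _             x≢2 = contradiction refl x≢2
    ≤2∧≢2⇒≤1 {suc (suc (suc _))} (s≤s (s≤s ())) _

  p≡2⇒double : p ≡ 2 → 2 ≤ mult G u v ⊎ 2 ≤ mult G v w
  p≡2⇒double p≡2 with ≤-total (mult G u v) (mult G v w)
  ... | inj₁ uv≤vw = inj₂ (≤-reflexive (trans (sym p≡2) (m≤n⇒m⊔n≡n uv≤vw)))
  ... | inj₂ vw≤uv = inj₁ (≤-reflexive (trans (sym p≡2) (m≥n⇒m⊔n≡m vw≤uv)))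

  private
    wt-newEdge : ∀ k → wt (lookup G' (newEdge k)) ≡ wt (lookup New k)
    wt-newEdge k = cong wt (lookup-rightIndex Old New k)

    Wt : Fin (length G) → Fin 2
    Wt e = wt (lookup G e)

    fu fw : Fin (length G)
    fu = proj₁ (proj₁ (proj₂ nbrs))
    fw = proj₁ (proj₁ (proj₂ (proj₂ nbrs)))

    ju : Joins u v (lookup G fu)
    ju = Joins-sym {ε = lookup G fu} (proj₂ (proj₁ (proj₂ nbrs)))

    jw : Joins v w (lookup G fw)
    jw = proj₂ (proj₁ (proj₂ (proj₂ nbrs)))

  newEdge-matching-uvw : ∀ {fa fb} → Joins u v (lookup G fa) → Joins v w (lookup G fb) →
                         ∃ λ k → wt (lookup G' (newEdge k)) ≡ Wt fa +₂ Wt fb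
  newEdge-matching-uvw {fa} {fb} ja jb with p ≟ℕ 2
  ... | yes p≡2 = let k , eq = newEdges-both-weights G v u w u' w' p≡2 (Wt fa +₂ Wt fb)
                  in k , trans (wt-newEdge k) eq
  ... | no  p≢2 = someNewEdge G v u w u' w' , (begin
    wt (lookup G' (newEdge _))           ≡⟨ wt-newEdge _ ⟩
    wt (lookup New _)                    ≡⟨ newEdges-summed-weight G v u w u' w' p≢2 _ ⟩
    edgeWeight G u v +₂ edgeWeight G v w ≡⟨ cong₂ _+₂_ (edgeWeight-unique G fa uv≤1 ja)
                                                    (edgeWeight-unique G fb vw≤1 jb) ⟩
    Wt fa +₂ Wt fb                       ∎)
    where
    open ≡-Reasoning
    uv≤1 = proj₁ (p≢2⇒simple p≢2)
    vw≤1 = proj₂ (p≢2⇒simple p≢2)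

  path-matching-uvw : ∀ k → ∃ λ fa → ∃ λ fb →
                      Joins u v (lookup G fa) × Joins v w (lookup G fb) ×
                      Wt fa +₂ Wt fb ≡ wt (lookup G' (newEdge k))
  path-matching-uvw k with p ≟ℕ 2
  ... | no p≢2 = fu , fw , ju , jw , sym (begin
    wt (lookup G' (newEdge k))           ≡⟨ wt-newEdge k ⟩
    wt (lookup New k)                    ≡⟨ newEdges-summed-weight G v u w u' w' p≢2 k ⟩
    edgeWeight G u v +₂ edgeWeight G v w ≡⟨ cong₂ _+₂_ (edgeWeight-unique G fu (proj₁ (p≢2⇒simple p≢2)) ju)
                                                        (edgeWeight-unique G fw (proj₂ (p≢2⇒simple p≢2)) jw) ⟩
    Wt fu +₂ Wt fw                       ∎)
    where open ≡-Reasoning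
  -- When p = 2 one side carries two edges of opposite weight, and one of them gives the parity.
  ... | yes p≡2 with p≡2⇒double p≡2
  ...   | inj₁ 2≤uv = let e₁ , e₂ , e₁≢e₂ , j₁ , j₂ = filter-length-two (joins? u v) G 2≤uv in
    case ≢⇒+₂-covers (opposite u v e₁ e₂ e₁≢e₂ j₁ j₂) (Wt fw) (wt (lookup G' (newEdge k))) of λ where
      (inj₁ eq) → e₁ , fw , j₁ , jw , eq
      (inj₂ eq) → e₂ , fw , j₂ , jw , eq
  ...   | inj₂ 2≤vw = let e₁ , e₂ , e₁≢e₂ , j₁ , j₂ = filter-length-two (joins? v w) G 2≤vw in
    case ≢⇒+₂-covers (opposite v w e₁ e₂ e₁≢e₂ j₁ j₂) (Wt fu) (wt (lookup G' (newEdge k))) of λ where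
      (inj₁ eq) → fu , e₁ , ju , j₁ , trans (+₂-comm (Wt fu) (Wt e₁)) eq
      (inj₂ eq) → fu , e₂ , ju , j₂ , trans (+₂-comm (Wt fu) (Wt e₂)) eq

  -- v itself has no image; it is sent to u' arbitrarily.
  dropVertex : Fin (suc n) → Fin n
  dropVertex x with v ≟ x
  ... | yes _   = u'
  ... | no  v≢x = punchOut v≢x

  punchIn-dropVertex : ∀ {x} → x ≢ v → punchIn v (dropVertex x) ≡ x
  punchIn-dropVertex {x} x≢v with v ≟ x
  ... | yes v≡x = contradiction (sym v≡x) x≢v
  ... | no  v≢x = Fin.punchIn-punchOut v≢x

  dropVertex-punchIn : ∀ x' → dropVertex (punchIn v x') ≡ x'
  dropVertex-punchIn x' = punchIn-inj v (punchIn-dropVertex (Fin.punchInᵢ≢i v x'))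

  dropVertex-u : dropVertex u ≡ u'
  dropVertex-u = trans (cong dropVertex (sym punchIn-u')) (dropVertex-punchIn u')

  dropVertex-w : dropVertex w ≡ w'
  dropVertex-w = trans (cong dropVertex (sym punchIn-w')) (dropVertex-punchIn w')

  newEdge-matching : ∀ {x y fa fb} → SamePair u w x y → Joins x v (lookup G fa) → Joins v y (lookup G fb) →
                     ∃ λ k → Joins (dropVertex x) (dropVertex y) (lookup G' (newEdge k)) ×
                             wt (lookup G' (newEdge k)) ≡ Wt fa +₂ Wt fb
  newEdge-matching {fa = fa} {fb} (inj₁ (refl , refl)) xv vy =
    let k , eq = newEdge-matching-uvw xv vy
    in k , subst₂ (λ a b → Joins a b (lookup G' (newEdge k)))
                  (sym dropVertex-u) (sym dropVertex-w) (newEdge-joins k) , eq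
  newEdge-matching {fa = fa} {fb} (inj₂ (refl , refl)) xv vy =
    let k , eq = newEdge-matching-uvw (Joins-sym {ε = lookup G fb} vy) (Joins-sym {ε = lookup G fa} xv)
    in k , subst₂ (λ a b → Joins a b (lookup G' (newEdge k))) (sym dropVertex-w) (sym dropVertex-u)
                  (Joins-sym {ε = lookup G' (newEdge k)} (newEdge-joins k))
         , trans eq (+₂-comm (Wt fb) (Wt fa))

  path-matching : ∀ {x' y'} k → Joins x' y' (lookup G' (newEdge k)) → ∃ λ fa → ∃ λ fb →
                  Joins (punchIn v x') v (lookup G fa) × Joins v (punchIn v y') (lookup G fb) ×
                  Wt fa +₂ Wt fb ≡ wt (lookup G' (newEdge k))
  path-matching k joins with Joins-ends {ε = lookup G' (newEdge k)} (newEdge-joins k) joins | path-matching-uvw k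
  ... | inj₁ (refl , refl) | fa , fb , ja , jb , eq =
    fa , fb , subst (λ a → Joins a v (lookup G fa)) (sym punchIn-u') ja
            , subst (λ b → Joins v b (lookup G fb)) (sym punchIn-w') jb , eq
  ... | inj₂ (refl , refl) | fa , fb , ja , jb , eq =
    fb , fa , subst (λ a → Joins a v (lookup G fb)) (sym punchIn-w') (Joins-sym {ε = lookup G fb} jb)
            , subst (λ b → Joins v b (lookup G fa)) (sym punchIn-u') (Joins-sym {ε = lookup G fa} ja)
            , trans (+₂-comm (Wt fb) (Wt fa)) eq

  origin-surjective : ∀ e → Avoids v (lookup G e) → ∃ λ j → origin j ≡ e
  origin-surjective e avoids = mapMaybe-origin-surjective (dropEdge v) G e (proj₂ (dropEdge-avoids v avoids))

  -- Edges at v have no image; they are sent to an arbitrary new edge.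
  dropArc : Fin (length G) → Fin (length G')
  dropArc e with avoids? v (lookup G e)
  ... | yes avoids = oldEdge (proj₁ (origin-surjective e avoids))
  ... | no  _      = newEdge (someNewEdge G v u w u' w')

  dropArc-old : ∀ {e} → Avoids v (lookup G e) → ∃ λ j → dropArc e ≡ oldEdge j × origin j ≡ e
  dropArc-old {e} avoids with avoids? v (lookup G e)
  ... | yes avoids′ = proj₁ (origin-surjective e avoids′) , refl , proj₂ (origin-surjective e avoids′)
  ... | no  ¬avoids = contradiction avoids ¬avoids

  projection : Embedding G G'
  projection = record
    { NodeDom      = _≢ v
    ; ArcDom       = Avoids v ∘ lookup G
    ; mapNode      = dropVertex
    ; mapArc       = dropArc
    ; mapNode-inj  = λ x≢v y≢v eq → trans (sym (punchIn-dropVertex x≢v))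
                                      (trans (cong (punchIn v) eq) (punchIn-dropVertex y≢v))
    ; mapArc-inj   = mapArc-inj
    ; mapArc-joins = mapArc-joins
    ; mapArc-wt    = mapArc-wt
    }
    where
    mapArc-inj : ∀ {e f} → Avoids v (lookup G e) → Avoids v (lookup G f) → dropArc e ≡ dropArc f → e ≡ f
    mapArc-inj ae af eq with dropArc-old ae | dropArc-old af
    ... | j , p , refl | j′ , p′ , refl = cong origin (leftIndex-injective Old New (trans (sym p) (trans eq p′)))

    mapArc-joins : ∀ {e x y} → Avoids v (lookup G e) → Joins x y (lookup G e) →
                   Joins (dropVertex x) (dropVertex y) (lookup G' (dropArc e))
    mapArc-joins {e} {x} {y} avoids joins with dropArc-old avoids | Avoids-Joins⇒≢ {ε = lookup G e} avoids joins
    ... | j , p , refl | x≢v , y≢v rewrite p =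
      Dropped-joins⁻ v (origin-dropped j)
        (subst₂ (λ a b → Joins a b (lookup G (origin j)))
                (sym (punchIn-dropVertex x≢v)) (sym (punchIn-dropVertex y≢v)) joins)

    mapArc-wt : ∀ {e} → Avoids v (lookup G e) → wt (lookup G' (dropArc e)) ≡ wt (lookup G e)
    mapArc-wt avoids with dropArc-old avoids
    ... | j , p , refl rewrite p = sym (origin-wt j)

  -- New edges have no single preimage; they are sent to an arbitrary edge.
  liftArc : Fin (length G') → Fin (length G)
  liftArc e' with old-or-new e'
  ... | inj₁ (j , _) = origin j
  ... | inj₂ _       = fu

  liftArc-old : ∀ j → liftArc (oldEdge j) ≡ origin j
  liftArc-old j with old-or-new (oldEdge j)
  ... | inj₁ (j′ , eq) = cong origin (leftIndex-injective Old New eq)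
  ... | inj₂ (k , eq)  = contradiction (sym eq) (leftIndex≢rightIndex Old New j k)

  lifting : Embedding G' G
  lifting = record
    { NodeDom      = λ _ → ⊤
    ; ArcDom       = IsOld
    ; mapNode      = punchIn v
    ; mapArc       = liftArc
    ; mapNode-inj  = λ _ _ → punchIn-inj v
    ; mapArc-inj   = λ where
        (j , refl) (j′ , refl) eq → cong oldEdge (mapMaybe-origin-injective (dropEdge v) G
                                      (trans (sym (liftArc-old j)) (trans eq (liftArc-old j′))))
    ; mapArc-joins = λ where
        (j , refl) joins → subst (Joins _ _ ∘ lookup G) (sym (liftArc-old j))
                            (Dropped-joins v (origin-dropped j) joins)
    ; mapArc-wt    = λ where
        (j , refl) → trans (cong (wt ∘ lookup G) (liftArc-old j)) (origin-wt j)
    }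

  isNew? : ∀ e' → Dec (IsNew e')
  isNew? e' with old-or-new e'
  ... | inj₁ (j , refl) = no λ (k , eq) → leftIndex≢rightIndex Old New j k (sym eq)
  ... | inj₂ new        = yes new

  ¬IsNew⇒IsOld : ∀ {e'} → ¬ IsNew e' → IsOld e'
  ¬IsNew⇒IsOld {e'} ¬new with old-or-new e'
  ... | inj₁ old = old
  ... | inj₂ new = contradiction new ¬new

  liftArc-avoids : ∀ {e'} → IsOld e' → Avoids v (lookup G (liftArc e'))
  liftArc-avoids (j , refl) = subst (Avoids v ∘ lookup G) (sym (liftArc-old j)) (Dropped-avoids v (origin-dropped j))

  Projects : Loop G → Loop G' → Set
  Projects L L' = ∀ {y} → Visits (path L') y → Visits (path L) (punchIn v y)

  LiftedFrom : Loop G' → Fin (suc n) → Set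
  LiftedFrom L' x = ∃ λ y → Visits (path L') y × punchIn v y ≡ x

  Lifts : Loop G' → Loop G → Set
  Lifts L' L = ∀ {x} → Visits (path L) x → x ≡ v ⊎ LiftedFrom L' x

  module _ (P : Path G) (avoid : ∀ {i} → i ≤ top P → node P i ≢ v) where

    arcs-avoid : ∀ {i} → i < top P → Avoids v (lookup G (arc P i))
    arcs-avoid {i} i< = Joins⇒Avoids {ε = lookup G (arc P i)} (arc-joins P i<) (avoid (<⇒≤ i<)) (avoid i<)

    projectPath : Path G'
    projectPath = mapPath projection P avoid arcs-avoid

    Visits-projectPath : ∀ {y} → Visits projectPath y → Visits P (punchIn v y)
    Visits-projectPath (i , i≤ , eq) = i , i≤ , trans (sym (punchIn-dropVertex (avoid i≤))) (cong (punchIn v) eq)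

  projectLoop : (L : Loop G) → (∀ {i} → i ≤ top (path L) → node (path L) i ≢ v) →
                Σ (Loop G') λ L' → loopWeight L' ≡ loopWeight L × Projects L L'
  projectLoop L avoid = mapLoop projection L avoid (arcs-avoid (path L) avoid) closing-avoids
                      , loopWeight-mapLoop projection L avoid (arcs-avoid (path L) avoid) closing-avoids
                      , Visits-projectPath (path L) avoid
    where
    closing-avoids : Avoids v (lookup G (closing L))
    closing-avoids = Joins⇒Avoids {ε = lookup G (closing L)} (closing-joins L) (avoid ≤-refl) (avoid z≤n)

  liftOldLoop : (L' : Loop G') → (∀ {i} → i ≤ top (path L') → IsOld (arcᶜ L' i)) →
                Σ (Loop G) λ L → loopWeight L ≡ loopWeight L' × (∀ {x} → Visits (path L) x → LiftedFrom L' x)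
  liftOldLoop L' old = mapLoop lifting L' (λ _ → tt) arcs-old closing-old
                     , loopWeight-mapLoop lifting L' (λ _ → tt) arcs-old closing-old
                     , λ (i , i≤ , eq) → node (path L') i , (i , i≤ , refl) , eq
    where
    arcs-old : ∀ {i} → i < top (path L') → IsOld (arc (path L') i)
    arcs-old i< = subst IsOld (arcᶜ-< L' i<) (old (<⇒≤ i<))
    closing-old : IsOld (closing L')
    closing-old = subst IsOld (arcᶜ-top L') (old ≤-refl)

  contractLoop : (L : Loop G) → node (path L) (top (path L)) ≡ v → 2 ≤ top (path L) →
                 Σ (Loop G') λ L' → loopWeight L' % 2 ≡ loopWeight L % 2 × Projects L L'
  contractLoop L last≡v 2≤K = L' , parity , Visits-≤ ∘ Visits-projectPath Q avoid
    where
    P = path L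
    K = top P
    Q = init P
    K₁ = pred K
    1≤K₁ : 1 ≤ K₁
    1≤K₁ = pred-mono-≤ 2≤K
    sucK₁≡K : suc K₁ ≡ K
    sucK₁≡K = suc-pred K {{>-nonZero (≤-trans (s≤s z≤n) 2≤K)}}
    avoid : ∀ {i} → i ≤ K₁ → node P i ≢ v
    avoid {i} i≤ eq = <-irrefl (node-inj P (≤pred⇒≤ i≤) ≤-refl (trans eq (sym last≡v)))
                              (subst (i <_) sucK₁≡K (s≤s i≤))
    Visits-≤ : ∀ {x} → Visits Q x → Visits P x
    Visits-≤ = Visits-init P
    x = node P K₁
    y = node P 0
    a = arc P K₁
    b = closing L
    xv : Joins x v (lookup G a)
    xv = subst (λ z → Joins x z (lookup G a)) (trans (cong (node P) sucK₁≡K) last≡v)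
         (arc-joins P (subst (K₁ <_) sucK₁≡K ≤-refl))
    vy : Joins v y (lookup G b)
    vy = subst (λ z → Joins z y (lookup G b)) last≡v (closing-joins L)
    x≢y : x ≢ y
    x≢y eq = contradiction (node-inj P (≤pred⇒≤ {n = K} ≤-refl) z≤n eq)
                            λ K₁≡0 → <-irrefl (sym K₁≡0) 1≤K₁
    matched = newEdge-matching (neighbours-of-v {e = a} xv vy x≢y) xv vy
    k = proj₁ matched
    L' : Loop G'
    L' = record
      { path          = projectPath Q avoid
      ; 1≤top         = 1≤K₁
      ; closing       = newEdge k
      ; closing-fresh = λ i< eq → let j , p , _ = dropArc-old (arcs-avoid Q avoid i<)
                                  in leftIndex≢rightIndex Old New j k (trans (sym p) eq)
      ; closing-joins = proj₁ (proj₂ matched)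
      }
    parity : loopWeight L' % 2 ≡ loopWeight L % 2
    parity = begin
      (pathWeight (projectPath Q avoid) + toℕ (wt (lookup G' (newEdge k)))) % 2
        ≡⟨ cong₂ (λ s t → (s + toℕ t) % 2) (pathWeight-mapPath projection Q avoid (arcs-avoid Q avoid))
            (proj₂ (proj₂ matched)) ⟩
      (pathWeight Q + toℕ (Wt a +₂ Wt b)) % 2
        ≡⟨ +-toℕ+₂ (pathWeight Q) (Wt a) (Wt b) ⟩
      (pathWeight Q + arcWeight G a + arcWeight G b) % 2
        ≡⟨ cong (λ s → (s + arcWeight G b) % 2) (pathWeight-init P (≤-trans (s≤s z≤n) 2≤K)) ⟨
      loopWeight L % 2 ∎
      where open ≡-Reasoning

  shortLoop-odd : (L : Loop G) → node (path L) (top (path L)) ≡ v → ¬ 2 ≤ top (path L) → loopWeight L % 2 ≡ 1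
  shortLoop-odd L last≡v ¬2≤K = twoLoop-odd L K≡1 (opposite v y (arc P 0) (closing L) arcs≢ va vb)
    where
    P = path L
    K≡1 : top P ≡ 1
    K≡1 with top P | 1≤top L
    ... | suc zero    | _ = refl
    ... | suc (suc _) | _ = contradiction (s≤s (s≤s z≤n)) ¬2≤K
    y = node P 0
    v≡node1 : v ≡ node P 1
    v≡node1 = trans (sym last≡v) (cong (node P) K≡1)
    arcs≢ : arc P 0 ≢ closing L
    arcs≢ = closing-fresh L (1≤top L)
    va : Joins v y (lookup G (arc P 0))
    va = subst (λ z → Joins z y (lookup G (arc P 0))) (sym v≡node1)
               (Joins-sym {ε = lookup G (arc P 0)} (arc-joins P (1≤top L)))
    vb : Joins v y (lookup G (closing L))
    vb = subst (λ z → Joins z y (lookup G (closing L))) last≡v (closing-joins L)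

  liftOneNewLoop : (L' : Loop G') → IsNew (closing L') →
                   (∀ {i} → i < top (path L') → IsOld (arc (path L') i)) →
                   Σ (Loop G) λ L → loopWeight L % 2 ≡ loopWeight L' % 2 × Lifts L' L
  liftOneNewLoop L' (k , closing≡) arcs-old = L , parity , lifts
    where
    P' = path L'
    K = top P'
    Q = mapPath lifting P' (λ _ → tt) arcs-old
    x' = node P' K
    y' = node P' 0
    matched = path-matching k (subst (Joins x' y' ∘ lookup G') (sym closing≡) (closing-joins L'))
    a = proj₁ matched
    b = proj₁ (proj₂ matched)
    xv : Joins (punchIn v x') v (lookup G a)
    xv = proj₁ (proj₂ (proj₂ matched))
    vy : Joins v (punchIn v y') (lookup G b)
    vy = proj₁ (proj₂ (proj₂ (proj₂ matched)))
    touches-v≢avoids : ∀ {e f x} → Joins x v (lookup G e) → Avoids v (lookup G f) → f ≢ e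
    touches-v≢avoids {e} tv avoids refl = Avoids⇒¬Joins {ε = lookup G e} avoids (Joins-sym {ε = lookup G e} tv)
    v-fresh : ∀ {i} → i ≤ K → node Q i ≢ v
    v-fresh _ = Fin.punchInᵢ≢i v _
    a-fresh : ∀ {i} → i < K → arc Q i ≢ a
    a-fresh i< = touches-v≢avoids {a} xv (liftArc-avoids (arcs-old i<))
    R : Path G
    R = snoc Q v a v-fresh a-fresh xv
    a≢b : a ≢ b
    a≢b a≡b = <-irrefl (sym (node-inj P' ≤-refl z≤n
                        (punchIn-inj v (Joins-other-end {ε = lookup G b} xv′ vy (Fin.punchInᵢ≢i v x')))))
                       (1≤top L')
      where xv′ = subst (Joins (punchIn v x') v ∘ lookup G) a≡b xv
    b-fresh : ∀ {i} → i < suc K → arc R i ≢ b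
    b-fresh i< with extend-≤ {f = arc Q} {a} (s≤s⁻¹ i<)
    ... | inj₁ (i<K , eq) = subst (_≢ b) (sym eq) (touches-v≢avoids (Joins-sym {ε = lookup G b} vy)
                            (liftArc-avoids (arcs-old i<K)))
    ... | inj₂ (_ , eq)   = subst (_≢ b) (sym eq) a≢b
    L : Loop G
    L = record
      { path          = R
      ; 1≤top         = s≤s z≤n
      ; closing       = b
      ; closing-fresh = b-fresh
      ; closing-joins = subst₂ (λ s t → Joins s t (lookup G b)) (sym (extend-top {k = suc K} {node Q} {v}))
                               (sym (extend-< {k = suc K} {f = node Q} {v} (s≤s z≤n))) vy
      }
    parity : loopWeight L % 2 ≡ loopWeight L' % 2
    parity = begin
      (pathWeight R + arcWeight G b) % 2
        ≡⟨ cong (λ s → (s + arcWeight G b) % 2) (pathWeight-snoc Q v a v-fresh a-fresh xv) ⟩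
      (pathWeight Q + arcWeight G a + arcWeight G b) % 2
        ≡⟨ cong (λ s → (s + arcWeight G a + arcWeight G b) % 2)
              (pathWeight-mapPath lifting P' (λ _ → tt) arcs-old) ⟩
      (pathWeight P' + arcWeight G a + arcWeight G b) % 2
        ≡⟨ +-toℕ+₂ (pathWeight P') (Wt a) (Wt b) ⟨
      (pathWeight P' + toℕ (Wt a +₂ Wt b)) % 2
        ≡⟨ cong (λ e → (pathWeight P' + toℕ e) % 2)
            (trans (proj₂ (proj₂ (proj₂ (proj₂ matched)))) (cong (wt ∘ lookup G') closing≡)) ⟩
      loopWeight L' % 2 ∎
      where open ≡-Reasoning
    lifts : Lifts L' L
    lifts visits with Visits-snoc Q v a v-fresh a-fresh xv visits
    ... | inj₁ (i , i≤ , eq) = inj₂ (node P' i , (i , i≤ , refl) , eq)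
    ... | inj₂ v≡x           = inj₁ (sym v≡x)

  twoNew-odd : (L' : Loop G') → IsNew (closing L') → ∀ {i} → i < top (path L') → IsNew (arc (path L') i) →
               loopWeight L' % 2 ≡ 1
  twoNew-odd L' (k , closing≡) {i} i<K (l , arc≡) = twoLoop-odd L' K≡1 weights≢
    where
    P' = path L'
    K = top P'
    outer : SamePair u' w' (node P' K) (node P' 0)
    outer = Joins-ends {ε = lookup G' (newEdge k)} (newEdge-joins k)
                       (subst (Joins _ _ ∘ lookup G') (sym closing≡) (closing-joins L'))
    inner : SamePair u' w' (node P' i) (node P' (suc i))
    inner = Joins-ends {ε = lookup G' (newEdge l)} (newEdge-joins l)
                       (subst (Joins _ _ ∘ lookup G') (sym arc≡) (arc-joins P' i<K))
    i≡0 : i ≡ 0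
    i≡0 with SamePair-fst outer inner
    ... | inj₁ eq = contradiction (node-inj P' (<⇒≤ i<K) ≤-refl eq) (<⇒≢ i<K)
    ... | inj₂ eq = node-inj P' (<⇒≤ i<K) z≤n eq
    sucI≡K : suc i ≡ K
    sucI≡K with SamePair-snd outer inner
    ... | inj₁ eq = node-inj P' i<K ≤-refl eq
    ... | inj₂ eq = contradiction (node-inj P' i<K z≤n eq) λ ()
    K≡1 : K ≡ 1
    K≡1 = trans (sym sucI≡K) (cong suc i≡0)
    weights≢ : wt (lookup G' (arc P' 0)) ≢ wt (lookup G' (closing L'))
    weights≢ = subst₂ (λ e f → wt (lookup G' e) ≢ wt (lookup G' f))
                      (trans arc≡ (cong (arc P') i≡0)) closing≡
                      (newEdge-opposite λ l≡k → closing-fresh L' i<K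
                        (trans (sym arc≡) (trans (cong newEdge l≡k) closing≡)))

  newEdge-visits : (L' : Loop G') → ∀ {i} → i ≤ top (path L') → IsNew (arcᶜ L' i) →
                   Visits (path L') u' × Visits (path L') w'
  newEdge-visits L' {i} i≤K (k , arc≡) with Joins-ends {ε = lookup G' (newEdge k)} (newEdge-joins k)
                                             (subst (Joins _ _ ∘ lookup G') (sym arc≡) (arcᶜ-joins L' i≤K))
  ... | inj₁ (p , q) = (i , i≤K , p) , (sucᶜ (top (path L')) i , sucᶜ-≤ i≤K , q)
  ... | inj₂ (p , q) = (sucᶜ (top (path L')) i , sucᶜ-≤ i≤K , q) , (i , i≤K , p)

  projectEvenLoop : (L : Loop G) → loopWeight L % 2 ≡ 0 →
                    Σ (Loop G') λ L' → loopWeight L' % 2 ≡ 0 × Projects L L'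
  projectEvenLoop L even with anyUpTo? (λ i → node (path L) i ≟ v) (suc (top (path L)))
  ... | no ¬through-v =
    let L' , weight≡ , projects = projectLoop L (λ i≤ eq → ¬through-v (_ , s≤s i≤ , eq))
    in L' , trans (cong (_% 2) weight≡) even , projects
  ... | yes (j , j≤ , node≡v) with rotateTo L j (s≤s⁻¹ j≤)
  ...   | r with 2 ≤? top (path (RotationAt.loop r))
  ...     | yes 2≤K = let L' , parity , projects = contractLoop loop last≡v 2≤K
                      in L' , trans parity even′ , visits ∘ projects
    where
    open RotationAt r
    last≡v = trans last-node node≡v
    even′ = trans (cong (_% 2) same-weight) even
  ...     | no ¬2≤K = contradiction (trans (sym (shortLoop-odd loop last≡v ¬2≤K)) even′) λ ()
    where
    open RotationAt r
    last≡v = trans last-node node≡v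
    even′ = trans (cong (_% 2) same-weight) even

  liftEvenLoop : (L' : Loop G') → loopWeight L' % 2 ≡ 0 →
                 Σ (Loop G) λ L → loopWeight L % 2 ≡ 0 × Lifts L' L
  liftEvenLoop L' even with anyUpTo? (isNew? ∘ arcᶜ L') (suc (top (path L')))
  ... | no ¬new =
    let L , weight≡ , lifts = liftOldLoop L' (λ i≤ → ¬IsNew⇒IsOld (λ new → ¬new (_ , s≤s i≤ , new)))
    in L , trans (cong (_% 2) weight≡) even , inj₂ ∘ lifts
  ... | yes (j , j≤ , new) with rotateTo L' j (s≤s⁻¹ j≤)
  ...   | r with anyUpTo? (isNew? ∘ arc (path (RotationAt.loop r))) (top (path (RotationAt.loop r)))
  ...     | yes (i , i< , new′) = contradiction (trans (sym (twoNew-odd loop closing-new i< new′)) even′) λ ()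
    where
    open RotationAt r
    closing-new = subst IsNew (sym closing-arc) new
    even′ = trans (cong (_% 2) same-weight) even
  ...     | no ¬new′ =
    let L , parity , lifts = liftOneNewLoop loop closing-new
                               (λ i< → ¬IsNew⇒IsOld (λ new′ → ¬new′ (_ , i< , new′)))
    in L , trans parity even′ ,
       λ x∈L → Data.Sum.map₂ (λ (y , y∈Q , eq) → y , visits y∈Q , eq) (lifts x∈L)
    where
    open RotationAt r
    closing-new = subst IsNew (sym closing-arc) new
    even′ = trans (cong (_% 2) same-weight) even

module SolutionTransfer {n : ℕ} (G : WGraph (suc n)) (S : Subset (suc n)) (k : ℕ)
                 (mult≤2 : MultAtMost2 G) (opposite : ParallelOpposite G) (degree : DegreeCondition G S)
                 (v u w : Fin (suc n)) (v∉S : v ∉ S) (nbrs : ExactlyTwoNeighbours G v u w)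
                 (v≢u : v ≢ u) (v≢w : v ≢ w) where
  open Reduction G v u w v≢u v≢w mult≤2 opposite nbrs

  S' : Subset n
  S' = restrictS v S

  ∉S⇒∈∁S' : ∀ {i} → punchIn v i ∉ S → i ∈ ∁ S'
  ∉S⇒∈∁S' i∉S = x∉p⇒x∈∁p (i∉S ∘ ∈-restrictS⁻ v)

  restrictS-⊆∁S' : ∀ {X} → X ⊆ ∁ S → restrictS v X ⊆ ∁ S'
  restrictS-⊆∁S' X⊆∁S = ∉S⇒∈∁S' ∘ x∈∁p⇒x∉p ∘ X⊆∁S ∘ ∈-restrictS⁻ v

  neighbourOutsideS : ∃ λ t' → punchIn v t' ∉ S × (t' ≡ u' ⊎ t' ≡ w')
  neighbourOutsideS with u ∈? S | w ∈? S
  ... | no u∉S | _      = u' , subst (_∉ S) (sym punchIn-u') u∉S , inj₁ refl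
  ... | yes _  | no w∉S = w' , subst (_∉ S) (sym punchIn-w') w∉S , inj₂ refl
  ... | yes u∈S | yes w∈S =
    contradiction (proj₂ (degree v v∉S) u w (proj₁ (proj₂ nbrs)) (proj₁ (proj₂ (proj₂ nbrs))) u∈S w∈S) u≢w

  yes-forward : YesInstance G S k → YesInstance G' S' k
  yes-forward (X , X⊆∁S , ∣X∣≤k , noEven) with v ∈? X
  ... | no v∉X = restrictS v X , restrictS-⊆∁S' X⊆∁S , ≤-trans (∣restrictS∣≤ v X) ∣X∣≤k
                 , noEvenCycle-transfer lift noEven
    where
    lift : EvenLoopAvoiding (restrictS v X) → EvenLoopAvoiding X
    lift (L' , even , avoids) =
      let L , even′ , lifts = liftEvenLoop L' even
      in L , even′ , λ visits x∈X → case lifts visits of λ where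
           (inj₁ refl)              → v∉X x∈X
           (inj₂ (y , y∈L' , refl)) → avoids y∈L' (∈-restrictS⁺ v x∈X)
  ... | yes v∈X = X' , X'⊆∁S' , ∣X'∣≤k , noEvenCycle-transfer lift noEven
    where
    t' = proj₁ neighbourOutsideS
    X' = ⁅ t' ⁆ ∪ restrictS v X
    X'⊆∁S' : X' ⊆ ∁ S'
    X'⊆∁S' y∈X' with x∈p∪q⁻ ⁅ t' ⁆ (restrictS v X) y∈X'
    ... | inj₁ y∈⁅t'⁆ =
      subst (_∈ ∁ S') (sym (x∈⁅y⁆⇒x≡y t' y∈⁅t'⁆)) (∉S⇒∈∁S' (proj₁ (proj₂ neighbourOutsideS)))
    ... | inj₂ y∈X    = restrictS-⊆∁S' X⊆∁S y∈X
    ∣X'∣≤k : ∣ X' ∣ ≤ k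
    ∣X'∣≤k = begin
      ∣ X' ∣                            ≤⟨ ∣p∪q∣≤∣p∣+∣q∣ ⁅ t' ⁆ (restrictS v X) ⟩
      ∣ ⁅ t' ⁆ ∣ + ∣ restrictS v X ∣    ≡⟨ cong (_+ ∣ restrictS v X ∣) (∣⁅x⁆∣≡1 t') ⟩
      suc ∣ restrictS v X ∣              ≤⟨ ∣restrictS∣< v X v∈X ⟩
      ∣ X ∣                             ≤⟨ ∣X∣≤k ⟩
      k                                 ∎
      where open ≤-Reasoning
    lift : EvenLoopAvoiding X' → EvenLoopAvoiding X
    lift (L' , even , avoids) with anyUpTo? (isNew? ∘ arcᶜ L') (suc (top (path L')))
    ... | yes (i , i≤ , new) = contradiction (x∈p∪q⁺ (inj₁ (x∈⁅x⁆ t'))) (avoids t'-visited)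
      where
      t'-visited : Visits (path L') t'
      t'-visited with proj₂ (proj₂ neighbourOutsideS) | newEdge-visits L' (s≤s⁻¹ i≤) new
      ... | inj₁ t'≡u' | u'-visited , _ = subst (Visits (path L')) (sym t'≡u') u'-visited
      ... | inj₂ t'≡w' | _ , w'-visited = subst (Visits (path L')) (sym t'≡w') w'-visited
    ... | no ¬new =
      let L , weight≡ , lifts = liftOldLoop L' (λ i≤ → ¬IsNew⇒IsOld (λ new → ¬new (_ , s≤s i≤ , new)))
      in L , trans (cong (_% 2) weight≡) even , λ visits x∈X → case lifts visits of λ where
           (y , y∈L' , refl) → avoids y∈L' (x∈p∪q⁺ (inj₂ (∈-restrictS⁺ v x∈X)))

  yes-backward : YesInstance G' S' k → YesInstance G S k
  yes-backward (X' , X'⊆∁S' , ∣X'∣≤k , noEven) =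
    X , X⊆∁S , subst (_≤ k) (sym (∣insertAt-outside∣ v X')) ∣X'∣≤k , noEvenCycle-transfer project noEven
    where
    X = Vec.insertAt X' v outside
    X⊆∁S : X ⊆ ∁ S
    X⊆∁S {x} x∈X with v ≟ x
    ... | yes refl = contradiction x∈X (v∉insertAt v X')
    ... | no  v≢x  = x∉p⇒x∈∁p λ x∈S →
      x∈∁p⇒x∉p (X'⊆∁S' (∈-insertAt⁻ v (subst (_∈ X) (sym punchIn-x) x∈X)))
               (∈-restrictS⁺ v (subst (_∈ S) (sym punchIn-x) x∈S))
      where punchIn-x = Fin.punchIn-punchOut v≢x
    project : EvenLoopAvoiding X → EvenLoopAvoiding X'
    project (L , even , avoids) =
      let L' , even′ , projects = projectEvenLoop L even
      in L' , even′ , λ visits y∈X' → avoids (projects visits) (∈-insertAt⁺ v y∈X')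

lemma5 : ∀ {n} (G : WGraph (suc n)) (S : Subset (suc n)) (k : ℕ)
    → Loopless G
    → NoEvenCycleAvoiding G S
    → MultAtMost2 G
    → ParallelOpposite G
    → DegreeCondition G S
    → (v u w : Fin (suc n))
    → v ∉ S
    → ExactlyTwoNeighbours G v u w
    → (v≢u : v ≢ u) → (v≢w : v ≢ w)
    → YesInstance G S k ⇔ YesInstance (reduce G v u w v≢u v≢w) (restrictS v S) k
lemma5 G S k _ _ mult≤2 opposite degree v u w v∉S nbrs v≢u v≢w = mk⇔ yes-forward yes-backward
  where open SolutionTransfer G S k mult≤2 opposite degree v u w v∉S nbrs v≢u v≢w
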